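{- Let $n\ge 27$. For each integer $a$ with $3\le a\le \lfloor (n+4)/5\rfloor$ and $n-a\equiv 0\pmod 2$, every integer in the interval $\left[\binom{a-1}{2}+1,\ \binom{a}{2}\right]$ is an eigenvalue of $\mathrm{Cay}(S_n,T_n)$.
   Context: $\mathrm{Cay}(S_n,T_n)$ is the Cayley graph with vertex set the symmetric group $S_n$, where $f,g$ are adjacent iff $fg^{ -1}$ is a transposition; its eigenvalues are those of its adjacency matrix. -}

module Defs where

open import Data.Nat using (ℕ; _<?_)
open import Data.Fin using (Fin; toℕ)
open import Data.Fin.Permutation.Components using (transpose)
open import Data.Integer using (ℤ; _*_; _+_; 0ℤ)
open import Data.List using (List; allFin; cartesianProduct; filter; map; foldr)
open import Data.Vec using (Vec; lookup) renaming (map to vmap)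
open import Data.Product using (_×_; _,_; proj₁; proj₂; Σ; ∃)
open import Relation.Binary.PropositionalEquality using (_≡_; _≢_)

-- Elements of S_n, represented in one-line notation: a vector σ of length n
-- with entries in Fin n (σ i = lookup σ i) that is injective (hence bijective).
IsPerm : ∀ {n} → Vec (Fin n) n → Set
IsPerm {n} σ = ∀ (i j : Fin n) → lookup σ i ≡ lookup σ j → i ≡ j

transpositions : (n : ℕ) → List (Fin n × Fin n)
transpositions n =
  filter (λ p → toℕ (proj₁ p) <? toℕ (proj₂ p)) (cartesianProduct (allFin n) (allFin n))

swapThen : ∀ {n} → Fin n × Fin n → Vec (Fin n) n → Vec (Fin n) n
swapThen (i , j) σ = vmap (transpose i j) σ

sumℤ : List ℤ → ℤ
sumℤ = foldr _+_ 0ℤ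

-- Action of the adjacency matrix of Cay(S_n, T_n) on a function x : S_n → ℤ.
-- g is adjacent to f iff f g⁻¹ = t is a transposition, i.e. f = t g; distinct t
-- give distinct neighbours, so (A x)(g) = Σ_{t ∈ T_n} x (t g).
adjAct : ∀ {n} → (Vec (Fin n) n → ℤ) → Vec (Fin n) n → ℤ
adjAct {n} x g = sumℤ (map (λ t → x (swapThen t g)) (transpositions n))

-- λ is an eigenvalue of Cay(S_n, T_n): there is a nonzero (integer) vector x on
-- the vertex set S_n with A x = λ x. (Values of x outside S_n are irrelevant.)
IsEigenvalue : (n : ℕ) → ℤ → Set
IsEigenvalue n λ′ =
  Σ (Vec (Fin n) n → ℤ) λ x →
    (∃ λ σ → IsPerm σ × x σ ≢ 0ℤ) ×
    (∀ g → IsPerm g → adjAct x g ≡ λ′ * x g)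

module Submission where

-- The eigenvector of a shape with column lengths h₁, …, h_m is a Specht polynomial: cut
-- the positions 0, …, n-1 into consecutive blocks of sizes hᵢ and multiply the Vandermonde
-- products of the blocks, evaluated at the positions g⁻¹(v).  Summing it over all
-- transpositions multiplies it by n plus twice the content of the shape.  Inside a block
-- the Vandermonde product is alternating; for two blocks of sizes p and q the exchanged
-- terms add up to min(p, q) times the product, by Lagrange interpolation, since a
-- polynomial of degree < p is determined by its values at p points.
--
-- The partition (a, ρ) with ρ = (3), (1), (5, 4, 2) or (d, 2, 1^(d-3)) has content
-- C(a,2) - d for d = 0, 1, 2 or d ≥ 3.  Adding a first row and a first column of equal
-- length leaves the content unchanged and absorbs the remaining cells; this is possible
-- because n - a is even and n ≥ 5a - 4.

module SpechtEigenvectors where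

  import Data.Integer.Properties as ℤₚ
  import Data.Nat.Properties as ℕₚ
  open import Defs using (IsEigenvalue; IsPerm; adjAct; sumℤ; swapThen; transpositions)
  open import Algebra.Properties.Semiring.Sum ℤₚ.+-*-semiring
    using (sum-cong-≗; sum-replicate-zero; ∑-distrib-+; ∑-comm; *-distribˡ-sum; *-distribʳ-sum)
    renaming (sum to ∑)
  open import Algebra.Properties.CommutativeMonoid.Sum ℤₚ.*-1-commutativeMonoid
    using () renaming (sum to ∏; sum-cong-≗ to ∏-cong-≗; sum-permute to ∏-permute)
  open import Data.Bool using (true; false; if_then_else_)
  open import Data.Nat as ℕ using (ℕ; zero; suc; z≤n; s≤s; _⊓_; _<_; _<?_)
  open import Data.Nat.Combinatorics using (_C_; nC1≡n; nCk+nC[k+1]≡[n+1]C[k+1])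
  open import Data.Nat.ListAction using (sum)
  import Data.Nat.Tactic.RingSolver as ℕ-Solver
  open import Data.Integer using (ℤ; +_; 0ℤ; 1ℤ; -1ℤ; _+_; _*_; -_; _-_)
  open import Data.Integer.Tactic.RingSolver using (solve-∀)
  open import Data.Fin using (Fin; zero; suc; toℕ; punchOut; _↑ˡ_; _↑ʳ_)
  open import Data.Fin.Properties
    using (_≟_; any?; suc-injective; toℕ-injective; ↑ˡ-injective; ↑ʳ-injective; injective⇒≤; punchOut-injective)
  open import Data.Fin.Permutation.Components using (transpose; transpose-inverse)
  import Data.Fin.Permutation as Perm
  open import Data.List using (List; []; _∷_; _++_; map; filter; cartesianProduct; allFin; tabulate; replicate; length)
  import Data.List.Properties as Listₚ
  open import Data.List.Relation.Unary.All as All using (All; []; _∷_)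
  import Data.List.Relation.Unary.All.Properties as Allₚ
  open import Data.Vec as Vec using (Vec; lookup)
  open import Data.Vec.Properties using (lookup-map; lookup-allFin)
  open import Data.Vec.Functional using (updateAt)
  open import Data.Vec.Functional.Properties using (updateAt-updates; updateAt-minimal; updateAt-id-local)
  open import Data.Product using (Σ-syntax; _×_; _,_)
  open import Data.Sum using (inj₁; inj₂)
  open import Function using (_∘_; const)
  open import Function.Definitions using (Injective)
  open import Level using (0ℓ)
  open import Relation.Binary.Definitions using (tri<; tri≈; tri>)
  open import Relation.Binary.PropositionalEquality
  open import Relation.Nullary using (Dec; yes; no; does)
  open import Relation.Nullary.Decidable using (dec-true; dec-false)
  open import Relation.Nullary.Negation using (contradiction)
  open import Relation.Unary using (Pred; Decidable)

  ∑-const : ∀ n (x : ℤ) → ∑ {n} (const x) ≡ + n * x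
  ∑-const zero    x = sym (ℤₚ.*-zeroˡ x)
  ∑-const (suc n) x = begin
    x + ∑ {n} (const x)  ≡⟨ cong (_+_ x) (∑-const n x) ⟩
    x + + n * x          ≡⟨ ℤₚ.suc-* (+ n) x ⟨
    + suc n * x          ∎
    where open ≡-Reasoning

  ∑-zero : ∀ {n} {f : Fin n → ℤ} → (∀ i → f i ≡ 0ℤ) → ∑ f ≡ 0ℤ
  ∑-zero {n} f≡0 = trans (sum-cong-≗ f≡0) (sum-replicate-zero n)

  ∑-single : ∀ {n} (f : Fin n → ℤ) i → (∀ j → j ≢ i → f j ≡ 0ℤ) → ∑ f ≡ f i
  ∑-single f zero    f≡0 = trans (cong (_+_ (f zero)) (∑-zero (λ j → f≡0 (suc j) λ ()))) (ℤₚ.+-identityʳ _)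
  ∑-single f (suc i) f≡0 = trans (cong (_+ ∑ (f ∘ suc)) (f≡0 zero λ ()))
    (trans (ℤₚ.+-identityˡ (∑ (f ∘ suc))) (∑-single (f ∘ suc) i λ j j≢i → f≡0 (suc j) (j≢i ∘ suc-injective)))

  ∑-↑ : ∀ m {n} (f : Fin (m ℕ.+ n) → ℤ) → ∑ f ≡ ∑ (λ i → f (i ↑ˡ n)) + ∑ (λ j → f (m ↑ʳ j))
  ∑-↑ zero    f = sym (ℤₚ.+-identityˡ _)
  ∑-↑ (suc m) f = trans (cong (_+_ (f zero)) (∑-↑ m (f ∘ suc))) (sym (ℤₚ.+-assoc (f zero) _ _))

  ∑∑-*ˡ : ∀ {m n} c (f : Fin m → Fin n → ℤ) → ∑ (λ i → ∑ (λ j → c * f i j)) ≡ c * ∑ (λ i → ∑ (λ j → f i j))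
  ∑∑-*ˡ c f = trans (sum-cong-≗ λ i → sym (*-distribˡ-sum c (f i))) (sym (*-distribˡ-sum c λ i → ∑ (f i)))

  ∑∑-*ʳ : ∀ {m n} c (f : Fin m → Fin n → ℤ) → ∑ (λ i → ∑ (λ j → f i j * c)) ≡ ∑ (λ i → ∑ (λ j → f i j)) * c
  ∑∑-*ʳ c f = trans (sum-cong-≗ λ i → sym (*-distribʳ-sum c (f i))) (sym (*-distribʳ-sum c λ i → ∑ (f i)))

  ∑∑-distrib-+ : ∀ {m n} (f g : Fin m → Fin n → ℤ) →
                 ∑ (λ i → ∑ (λ j → f i j + g i j)) ≡ ∑ (λ i → ∑ (λ j → f i j)) + ∑ (λ i → ∑ (λ j → g i j))
  ∑∑-distrib-+ f g = trans (sum-cong-≗ λ i → ∑-distrib-+ (f i) (g i)) (∑-distrib-+ (λ i → ∑ (f i)) (λ i → ∑ (g i)))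

  ∑∑-↑ : ∀ m n (f : Fin (m ℕ.+ n) → Fin (m ℕ.+ n) → ℤ) →
         ∑ (λ x → ∑ (λ y → f x y)) ≡
           (∑ (λ i → ∑ (λ j → f (i ↑ˡ n) (j ↑ˡ n))) + ∑ (λ i → ∑ (λ j → f (i ↑ˡ n) (m ↑ʳ j)))) +
           (∑ (λ i → ∑ (λ j → f (m ↑ʳ i) (j ↑ˡ n))) + ∑ (λ i → ∑ (λ j → f (m ↑ʳ i) (m ↑ʳ j))))
  ∑∑-↑ m n f = trans (∑-↑ m (λ x → ∑ (f x))) (cong₂ _+_
    (trans (sum-cong-≗ λ i → ∑-↑ m (f (i ↑ˡ n)))
           (∑-distrib-+ (λ i → ∑ (λ j → f (i ↑ˡ n) (j ↑ˡ n))) (λ i → ∑ (λ j → f (i ↑ˡ n) (m ↑ʳ j)))))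
    (trans (sum-cong-≗ λ i → ∑-↑ m (f (m ↑ʳ i)))
           (∑-distrib-+ (λ i → ∑ (λ j → f (m ↑ʳ i) (j ↑ˡ n))) (λ i → ∑ (λ j → f (m ↑ʳ i) (m ↑ʳ j))))))

  ∏-nonzero : ∀ {n} (f : Fin n → ℤ) → (∀ i → f i ≢ 0ℤ) → ∏ f ≢ 0ℤ
  ∏-nonzero {zero}  f f≢0 ()
  ∏-nonzero {suc n} f f≢0 eq with ℤₚ.i*j≡0⇒i≡0∨j≡0 (f zero) eq
  ... | inj₁ f0≡0 = f≢0 zero f0≡0
  ... | inj₂ rest≡0 = ∏-nonzero (f ∘ suc) (f≢0 ∘ suc) rest≡0

  ∏-transpose : ∀ {n} (f : Fin n → ℤ) i j → ∏ (f ∘ transpose i j) ≡ ∏ f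
  ∏-transpose f i j = sym (∏-permute f (Perm.transpose i j))

  module _ {n : ℕ} where

    transpose-matchˡ : (i j : Fin n) → transpose i j i ≡ j
    transpose-matchˡ i j with i ≟ i
    ... | yes _ = refl
    ... | no i≢i = contradiction refl i≢i

    transpose-matchʳ : (i j : Fin n) → transpose i j j ≡ i
    transpose-matchʳ i j with j ≟ i
    ... | yes refl = refl
    ... | no _ with j ≟ j
    ...   | yes _ = refl
    ...   | no j≢j = contradiction refl j≢j

    transpose-unmatched : ∀ {i j k : Fin n} → k ≢ i → k ≢ j → transpose i j k ≡ k
    transpose-unmatched {i} {j} {k} k≢i k≢j with k ≟ i
    ... | yes k≡i = contradiction k≡i k≢i
    ... | no _ with k ≟ j
    ...   | yes k≡j = contradiction k≡j k≢j
    ...   | no _ = refl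

    transpose-comm : (i j k : Fin n) → transpose i j k ≡ transpose j i k
    transpose-comm i j k = by-cases (k ≟ i) (k ≟ j)
      where
      by-cases : Dec (k ≡ i) → Dec (k ≡ j) → transpose i j k ≡ transpose j i k
      by-cases (yes refl) (yes refl) = refl
      by-cases (yes refl) (no k≢j)   = trans (transpose-matchˡ k j) (sym (transpose-matchʳ j k))
      by-cases (no k≢i)   (yes refl) = trans (transpose-matchʳ i k) (sym (transpose-matchˡ k i))
      by-cases (no k≢i)   (no k≢j)   = trans (transpose-unmatched k≢i k≢j) (sym (transpose-unmatched k≢j k≢i))

    transpose-involutive : (i j k : Fin n) → transpose i j (transpose i j k) ≡ k
    transpose-involutive i j k = trans (cong (transpose i j) (transpose-comm i j k)) (transpose-inverse i j)

    transpose-same : (i k : Fin n) → transpose i i k ≡ k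
    transpose-same i k = by-cases (k ≟ i)
      where
      by-cases : Dec (k ≡ i) → transpose i i k ≡ k
      by-cases (yes refl) = transpose-matchˡ k k
      by-cases (no k≢i)   = transpose-unmatched k≢i k≢i

    transpose-injective : (i j : Fin n) → Injective _≡_ _≡_ (transpose i j)
    transpose-injective i j {k} {l} eq =
      trans (sym (transpose-involutive i j k)) (trans (cong (transpose i j) eq) (transpose-involutive i j l))

  transpose-invariant : ∀ {n} {A : Set} (f : Fin n → A) {i j} → f i ≡ f j → ∀ k → f (transpose i j k) ≡ f k
  transpose-invariant f {i} {j} fi≡fj k = by-cases (k ≟ i) (k ≟ j)
    where
    by-cases : Dec (k ≡ i) → Dec (k ≡ j) → f (transpose i j k) ≡ f k
    by-cases (yes refl) _          = trans (cong f (transpose-matchˡ k j)) (sym fi≡fj)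
    by-cases (no _)     (yes refl) = trans (cong f (transpose-matchʳ i k)) fi≡fj
    by-cases (no k≢i)   (no k≢j)   = cong f (transpose-unmatched k≢i k≢j)

  transpose-map : ∀ {m n} {e : Fin m → Fin n} → Injective _≡_ _≡_ e →
                  (i j k : Fin m) → transpose (e i) (e j) (e k) ≡ e (transpose i j k)
  transpose-map {e = e} e-inj i j k = by-cases (k ≟ i) (k ≟ j)
    where
    by-cases : Dec (k ≡ i) → Dec (k ≡ j) → transpose (e i) (e j) (e k) ≡ e (transpose i j k)
    by-cases (yes refl) _          = trans (transpose-matchˡ (e k) (e j)) (cong e (sym (transpose-matchˡ k j)))
    by-cases (no k≢i)   (yes refl) = trans (transpose-matchʳ (e i) (e k)) (cong e (sym (transpose-matchʳ i k)))
    by-cases (no k≢i)   (no k≢j)   =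
      trans (transpose-unmatched (k≢i ∘ e-inj) (k≢j ∘ e-inj)) (cong e (sym (transpose-unmatched k≢i k≢j)))

  ↑ˡ≢↑ʳ : ∀ {m} n (i : Fin m) (j : Fin n) → i ↑ˡ n ≢ m ↑ʳ j
  ↑ˡ≢↑ʳ n zero    j ()
  ↑ˡ≢↑ʳ n (suc i) j eq = ↑ˡ≢↑ʳ n i j (suc-injective eq)

  infixl 6 _[_]≔_
  _[_]≔_ : ∀ {n} {A : Set} → (Fin n → A) → Fin n → A → Fin n → A
  xs [ i ]≔ u = updateAt xs i (const u)

  []≔-∘ : ∀ {m n} {A : Set} {π : Fin m → Fin n} → Injective _≡_ _≡_ π →
             (xs : Fin n → A) (i : Fin m) (u : A) (k : Fin m) → (xs [ π i ]≔ u) (π k) ≡ ((xs ∘ π) [ i ]≔ u) k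
  []≔-∘ {π = π} π-inj xs i u k = by-cases (k ≟ i)
    where
    by-cases : Dec (k ≡ i) → (xs [ π i ]≔ u) (π k) ≡ ((xs ∘ π) [ i ]≔ u) k
    by-cases (yes refl) = trans (updateAt-updates (π k) xs) (sym (updateAt-updates k (xs ∘ π)))
    by-cases (no k≢i)   =
      trans (updateAt-minimal (π k) (π i) xs (k≢i ∘ π-inj)) (sym (updateAt-minimal k i (xs ∘ π) k≢i))

  transpose-across : ∀ {a b c} {A : Set} {e : Fin a → Fin c} {e′ : Fin b → Fin c} →
                     Injective _≡_ _≡_ e → (∀ x y → e x ≢ e′ y) →
                     (z : Fin c → A) (i : Fin a) (j : Fin b) (k : Fin a) →
                     z (transpose (e i) (e′ j) (e k)) ≡ ((z ∘ e) [ i ]≔ z (e′ j)) k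
  transpose-across {e = e} {e′} e-inj disjoint z i j k = by-cases (k ≟ i)
    where
    by-cases : Dec (k ≡ i) → z (transpose (e i) (e′ j) (e k)) ≡ ((z ∘ e) [ i ]≔ z (e′ j)) k
    by-cases (yes refl) = trans (cong z (transpose-matchˡ (e k) (e′ j))) (sym (updateAt-updates k (z ∘ e)))
    by-cases (no k≢i)   = trans (cong z (transpose-unmatched (k≢i ∘ e-inj) (disjoint k j)))
                                (sym (updateAt-minimal k i (z ∘ e) k≢i))

  -- Polynomial functions of bounded degree

  -- The factor theorem taken as definition: f has degree < suc d iff for every r,
  -- f u = (u - r) q u + f r with q of degree < d.
  data DegreeBelow : ℕ → (ℤ → ℤ) → Set where
    vanishing : ∀ {f} → (∀ u → f u ≡ 0ℤ) → DegreeBelow zero f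
    factors   : ∀ {d f} → (∀ r → Σ[ q ∈ (ℤ → ℤ) ] DegreeBelow d q × (∀ u → f u ≡ (u - r) * q u + f r)) →
                DegreeBelow (suc d) f

  degree-cong : ∀ {d f g} → (∀ u → f u ≡ g u) → DegreeBelow d f → DegreeBelow d g
  degree-cong f≗g (vanishing f≡0) = vanishing λ u → trans (sym (f≗g u)) (f≡0 u)
  degree-cong f≗g (factors f≡) = factors λ r → let q , q-deg , f≡′ = f≡ r in
    q , q-deg , λ u → trans (sym (f≗g u)) (trans (f≡′ u) (cong (_+_ ((u - r) * q u)) (f≗g r)))

  degree-zero : ∀ {d} → DegreeBelow d (const 0ℤ)
  degree-zero {zero}  = vanishing λ _ → refl
  degree-zero {suc d} = factors λ r → const 0ℤ , degree-zero , λ u → sym (cong (_+ 0ℤ) (ℤₚ.*-zeroʳ (u - r)))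

  degree-const : ∀ c → DegreeBelow 1 (const c)
  degree-const c = factors λ r →
    const 0ℤ , degree-zero , λ u → sym (trans (cong (_+ c) (ℤₚ.*-zeroʳ (u - r))) (ℤₚ.+-identityˡ c))

  degree-mono : ∀ {d d′ f} → d ℕ.≤ d′ → DegreeBelow d f → DegreeBelow d′ f
  degree-mono z≤n     (vanishing f≡0) = degree-cong (sym ∘ f≡0) degree-zero
  degree-mono (s≤s p) (factors f≡)    = factors λ r → let q , q-deg , f≡′ = f≡ r in q , degree-mono p q-deg , f≡′

  degree-+ : ∀ {d f g} → DegreeBelow d f → DegreeBelow d g → DegreeBelow d (λ u → f u + g u)
  degree-+ (vanishing f≡0) (vanishing g≡0) = vanishing λ u → cong₂ _+_ (f≡0 u) (g≡0 u)
  degree-+ {f = f} {g} (factors f≡) (factors g≡) = factors λ r →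
    let p , p-deg , f≡′ = f≡ r
        q , q-deg , g≡′ = g≡ r
    in (λ u → p u + q u) , degree-+ p-deg q-deg ,
       λ u → trans (cong₂ _+_ (f≡′ u) (g≡′ u)) (regroup (u - r) (p u) (q u) (f r) (g r))
    where
    regroup : ∀ x a b c e → (x * a + c) + (x * b + e) ≡ x * (a + b) + (c + e)
    regroup = solve-∀

  degree-scale : ∀ {d f} c → DegreeBelow d f → DegreeBelow d (λ u → c * f u)
  degree-scale c (vanishing f≡0) = vanishing λ u → trans (cong (c *_) (f≡0 u)) (ℤₚ.*-zeroʳ c)
  degree-scale {f = f} c (factors f≡) = factors λ r → let q , q-deg , f≡′ = f≡ r in
    (λ u → c * q u) , degree-scale c q-deg , λ u → trans (cong (c *_) (f≡′ u)) (distrib c (u - r) (q u) (f r))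
    where
    distrib : ∀ c x a b → c * (x * a + b) ≡ x * (c * a) + c * b
    distrib = solve-∀

  degree-linear : ∀ {d f} s → DegreeBelow d f → DegreeBelow (suc d) (λ u → (u - s) * f u)
  degree-linear {f = f} s (vanishing f≡0) = factors λ r → const 0ℤ , vanishing (λ _ → refl) , λ u → begin
    (u - s) * f u                  ≡⟨ cong ((u - s) *_) (f≡0 u) ⟩
    (u - s) * 0ℤ                   ≡⟨ vanish u r s ⟩
    (u - r) * 0ℤ + (r - s) * 0ℤ    ≡⟨ cong (λ y → (u - r) * 0ℤ + (r - s) * y) (f≡0 r) ⟨
    (u - r) * 0ℤ + (r - s) * f r   ∎
    where
    open ≡-Reasoning
    vanish : ∀ u r s → (u - s) * 0ℤ ≡ (u - r) * 0ℤ + (r - s) * 0ℤ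
    vanish = solve-∀
  degree-linear {f = f} s f-deg@(factors f≡) = factors λ r → let q , q-deg , f≡′ = f≡ r in
    (λ u → f u + (r - s) * q u) , degree-+ f-deg (degree-scale (r - s) (degree-mono (ℕₚ.n≤1+n _) q-deg)) ,
    λ u → shift u r (f u) (q u) (f≡′ u)
    where
    shift : ∀ u r y z → y ≡ (u - r) * z + f r → (u - s) * y ≡ (u - r) * (y + (r - s) * z) + (r - s) * f r
    shift u r y z refl = identity u r s z (f r)
      where
      identity : ∀ u r s z c → (u - s) * ((u - r) * z + c) ≡ (u - r) * (((u - r) * z + c) + (r - s) * z) + (r - s) * c
      identity = solve-∀

  degree-∑ : ∀ {d n} (f : Fin n → ℤ → ℤ) → (∀ i → DegreeBelow d (f i)) → DegreeBelow d (λ u → ∑ (λ i → f i u))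
  degree-∑ {n = zero}  f f-deg = degree-zero
  degree-∑ {n = suc n} f f-deg = degree-+ (f-deg zero) (degree-∑ (f ∘ suc) (f-deg ∘ suc))

  degree-roots : ∀ {d f} → DegreeBelow d f → (X : Fin d → ℤ) → Injective _≡_ _≡_ X →
                 (∀ i → f (X i) ≡ 0ℤ) → ∀ u → f u ≡ 0ℤ
  degree-roots (vanishing f≡0) X X-inj roots = f≡0
  degree-roots {f = f} (factors f≡) X X-inj roots u with f≡ (X zero)
  ... | q , q-deg , f≡′ = begin
    f u                                ≡⟨ f≡′ u ⟩
    (u - X zero) * q u + f (X zero)    ≡⟨ cong₂ (λ a b → (u - X zero) * a + b) (q≡0 u) (roots zero) ⟩
    (u - X zero) * 0ℤ + 0ℤ             ≡⟨ cong (_+ 0ℤ) (ℤₚ.*-zeroʳ (u - X zero)) ⟩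
    0ℤ                                 ∎
    where
    open ≡-Reasoning
    q-roots : ∀ i → q (X (suc i)) ≡ 0ℤ
    q-roots i with ℤₚ.i*j≡0⇒i≡0∨j≡0 (Xi - X zero) {q Xi} (begin
        (Xi - X zero) * q Xi               ≡⟨ ℤₚ.+-identityʳ _ ⟨
        (Xi - X zero) * q Xi + 0ℤ          ≡⟨ cong (_+_ ((Xi - X zero) * q Xi)) (roots zero) ⟨
        (Xi - X zero) * q Xi + f (X zero)  ≡⟨ f≡′ Xi ⟨
        f Xi                               ≡⟨ roots (suc i) ⟩
        0ℤ                                 ∎)
      where Xi = X (suc i)
    ... | inj₁ Xi-X0≡0 = contradiction (X-inj (ℤₚ.i-j≡0⇒i≡j _ _ Xi-X0≡0)) λ ()
    ... | inj₂ qXi≡0   = qXi≡0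
    q≡0 : ∀ u → q u ≡ 0ℤ
    q≡0 = degree-roots q-deg (X ∘ suc) (suc-injective ∘ X-inj) q-roots

  -- Vandermonde products

  Δ : ∀ {p} → (Fin p → ℤ) → ℤ
  Δ {zero}  X = 1ℤ
  Δ {suc p} X = ∏ (λ j → X zero - X (suc j)) * Δ (X ∘ suc)

  Δ-cong : ∀ {p} {X Y : Fin p → ℤ} → (∀ i → X i ≡ Y i) → Δ X ≡ Δ Y
  Δ-cong {zero}  X≗Y = refl
  Δ-cong {suc p} X≗Y = cong₂ _*_ (∏-cong-≗ λ j → cong₂ _-_ (X≗Y zero) (X≗Y (suc j))) (Δ-cong (X≗Y ∘ suc))

  Δ-antisym-01 : ∀ {p} (X : Fin (suc (suc p)) → ℤ) → Δ (X ∘ transpose zero (suc zero)) ≡ - Δ X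
  Δ-antisym-01 {p} X = trans (Δ-cong swapped-≗) (swap-factors (X zero) (X (suc zero)) _ _ (Δ (λ k → X (suc (suc k)))))
    where
    swapped : Fin (suc (suc p)) → ℤ
    swapped zero          = X (suc zero)
    swapped (suc zero)    = X zero
    swapped (suc (suc k)) = X (suc (suc k))
    swapped-≗ : ∀ k → X (transpose zero (suc zero) k) ≡ swapped k
    swapped-≗ zero          = cong X (transpose-matchˡ zero (suc zero))
    swapped-≗ (suc zero)    = cong X (transpose-matchʳ zero (suc zero))
    swapped-≗ (suc (suc k)) = cong X (transpose-unmatched {i = zero} {suc zero} (λ ()) (λ ()))
    swap-factors : ∀ a b pa pb d → ((b - a) * pb) * (pa * d) ≡ - (((a - b) * pa) * (pb * d))
    swap-factors = solve-∀

  Δ-antisym-lift : ∀ {p} → (∀ (Y : Fin p → ℤ) {i j} → i ≢ j → Δ (Y ∘ transpose i j) ≡ - Δ Y) →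
                   ∀ (X : Fin (suc p) → ℤ) {i j} → i ≢ j → Δ (X ∘ transpose (suc i) (suc j)) ≡ - Δ X
  Δ-antisym-lift {p} Δ-antisym′ X {i} {j} i≢j = begin
    Δ (X ∘ transpose (suc i) (suc j))                               ≡⟨ Δ-cong lifted-≗ ⟩
    ∏ (λ k → X zero - X (suc (transpose i j k))) * Δ (X ∘ suc ∘ transpose i j)
      ≡⟨ cong₂ _*_ (∏-transpose (λ k → X zero - X (suc k)) i j) (Δ-antisym′ (X ∘ suc) i≢j) ⟩
    ∏ (λ k → X zero - X (suc k)) * - Δ (X ∘ suc)
      ≡⟨ ℤₚ.neg-distribʳ-* (∏ (λ k → X zero - X (suc k))) (Δ (X ∘ suc)) ⟨
    - Δ X                                                           ∎
    where
    open ≡-Reasoning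
    lifted : Fin (suc p) → ℤ
    lifted zero    = X zero
    lifted (suc k) = X (suc (transpose i j k))
    lifted-≗ : ∀ k → X (transpose (suc i) (suc j) k) ≡ lifted k
    lifted-≗ zero    = cong X (transpose-unmatched {i = suc i} {suc j} (λ ()) (λ ()))
    lifted-≗ (suc k) = cong X (transpose-map suc-injective i j k)

  Δ-antisym      : ∀ {p} (X : Fin p → ℤ) {i j} → i ≢ j → Δ (X ∘ transpose i j) ≡ - Δ X
  Δ-antisym-zero : ∀ {p} (X : Fin (suc p) → ℤ) j → Δ (X ∘ transpose zero (suc j)) ≡ - Δ X

  Δ-antisym {suc p} X {zero}  {zero}  0≢0 = contradiction refl 0≢0
  Δ-antisym {suc p} X {zero}  {suc j} _   = Δ-antisym-zero X j
  Δ-antisym {suc p} X {suc i} {zero}  _   =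
    trans (Δ-cong (cong X ∘ transpose-comm (suc i) zero)) (Δ-antisym-zero X i)
  Δ-antisym {suc p} X {suc i} {suc j} i≢j = Δ-antisym-lift (λ Y → Δ-antisym Y) X (i≢j ∘ cong suc)

  Δ-antisym-zero X zero    = Δ-antisym-01 X
  -- transpose 0 j′ is the conjugate of transpose 0 1 by σ = transpose 1 j′.
  Δ-antisym-zero X (suc j) = begin
    Δ (X ∘ transpose zero j′)     ≡⟨ Δ-cong (cong X ∘ conjugate) ⟩
    Δ (X ∘ σ ∘ t₀₁ ∘ σ)           ≡⟨ Δ-antisym-lift (λ Y → Δ-antisym Y) (X ∘ σ ∘ t₀₁) {zero} {suc j} (λ ()) ⟩
    - Δ (X ∘ σ ∘ t₀₁)             ≡⟨ cong -_ (Δ-antisym-01 (X ∘ σ)) ⟩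
    - - Δ (X ∘ σ)                 ≡⟨ ℤₚ.neg-involutive _ ⟩
    Δ (X ∘ σ)                     ≡⟨ Δ-antisym-lift (λ Y → Δ-antisym Y) X {zero} {suc j} (λ ()) ⟩
    - Δ X                         ∎
    where
    open ≡-Reasoning
    j′ = suc (suc j)
    t₀₁ = transpose zero (suc zero)
    σ = transpose (suc zero) j′
    conjugate : ∀ k → transpose zero j′ k ≡ σ (t₀₁ (σ k))
    conjugate k = begin
      transpose zero j′ k                  ≡⟨ cong₂ (λ a b → transpose a b k) σ0 (transpose-matchˡ (suc zero) j′) ⟨
      transpose (σ zero) (σ (suc zero)) k  ≡⟨ cong (transpose _ _) (transpose-involutive (suc zero) j′ k) ⟨
      transpose (σ zero) (σ (suc zero)) (σ (σ k))
        ≡⟨ transpose-map (transpose-injective (suc zero) j′) zero (suc zero) (σ k) ⟩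
      σ (t₀₁ (σ k))                        ∎
      where σ0 = transpose-unmatched {i = suc zero} {j′} (λ ()) (λ ())

  x≡-x⇒x≡0 : ∀ {x} → x ≡ - x → x ≡ 0ℤ
  x≡-x⇒x≡0 {x} x≡-x = ℤₚ.*-cancelˡ-≡ (+ 2) x 0ℤ (begin
    + 2 * x    ≡⟨ double x ⟩
    x + x      ≡⟨ cong (_+_ x) x≡-x ⟩
    x + - x    ≡⟨ ℤₚ.+-inverseʳ x ⟩
    0ℤ         ≡⟨ ℤₚ.*-zeroʳ (+ 2) ⟨
    + 2 * 0ℤ   ∎)
    where
    open ≡-Reasoning
    double : ∀ x → + 2 * x ≡ x + x
    double = solve-∀

  Δ-repeat : ∀ {p} (X : Fin p → ℤ) {i j} → i ≢ j → X i ≡ X j → Δ X ≡ 0ℤ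
  Δ-repeat X i≢j Xi≡Xj = x≡-x⇒x≡0 (trans (sym (Δ-cong (transpose-invariant X Xi≡Xj))) (Δ-antisym X i≢j))

  Δ-nonzero : ∀ {p} (X : Fin p → ℤ) → Injective _≡_ _≡_ X → Δ X ≢ 0ℤ
  Δ-nonzero {zero}  X X-inj ()
  Δ-nonzero {suc p} X X-inj Δ≡0 with ℤₚ.i*j≡0⇒i≡0∨j≡0 (∏ (λ j → X zero - X (suc j))) Δ≡0
  ... | inj₁ prod≡0 = ∏-nonzero (λ j → X zero - X (suc j)) factor≢0 prod≡0
    where
    factor≢0 : ∀ j → X zero - X (suc j) ≢ 0ℤ
    factor≢0 j e = contradiction (X-inj (ℤₚ.i-j≡0⇒i≡j (X zero) (X (suc j)) e)) λ ()
  ... | inj₂ rest≡0 = Δ-nonzero (X ∘ suc) (suc-injective ∘ X-inj) rest≡0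

  Δ-transposition-row : ∀ {p} (X : Fin p → ℤ) i → ∑ (λ j → Δ (X ∘ transpose i j)) ≡ (+ 2 - + p) * Δ X
  Δ-transposition-row {p} X i = begin
    ∑ row                              ≡⟨ add-sub (∑ row) (+ p * Δ X) ⟩
    (∑ row + + p * Δ X) - + p * Δ X    ≡⟨ cong (_- + p * Δ X) row-plus ⟩
    (Δ X + Δ X) - + p * Δ X            ≡⟨ factor (+ p) (Δ X) ⟩
    (+ 2 - + p) * Δ X                  ∎
    where
    open ≡-Reasoning
    row : Fin p → ℤ
    row j = Δ (X ∘ transpose i j)
    row-plus : ∑ row + + p * Δ X ≡ Δ X + Δ X
    row-plus = begin
      ∑ row + + p * Δ X            ≡⟨ cong (_+_ (∑ row)) (∑-const p (Δ X)) ⟨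
      ∑ row + ∑ {p} (const (Δ X))  ≡⟨ ∑-distrib-+ row (const (Δ X)) ⟨
      ∑ (λ j → row j + Δ X)        ≡⟨ ∑-single (λ j → row j + Δ X) i off-diagonal ⟩
      row i + Δ X                  ≡⟨ cong (_+ Δ X) (Δ-cong (cong X ∘ transpose-same i)) ⟩
      Δ X + Δ X                    ∎
      where
      off-diagonal : ∀ j → j ≢ i → row j + Δ X ≡ 0ℤ
      off-diagonal j j≢i = trans (cong (_+ Δ X) (Δ-antisym X (j≢i ∘ sym))) (ℤₚ.+-inverseˡ (Δ X))
    add-sub : ∀ a b → a ≡ (a + b) - b
    add-sub = solve-∀
    factor : ∀ p d → (d + d) - p * d ≡ (+ 2 - p) * d
    factor = solve-∀

  ∏-factors-degree : ∀ {m} (Y : Fin m → ℤ) → DegreeBelow (suc m) (λ u → ∏ (λ j → u - Y j))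
  ∏-factors-degree {zero}  Y = degree-const 1ℤ
  ∏-factors-degree {suc m} Y = degree-linear (Y zero) (∏-factors-degree (Y ∘ suc))

  Δ-update-degree : ∀ {p} (X : Fin p → ℤ) i → DegreeBelow p (λ u → Δ (X [ i ]≔ u))
  Δ-update-degree {suc p} X zero =
    degree-cong (λ u → ℤₚ.*-comm (Δ (X ∘ suc)) _) (degree-scale (Δ (X ∘ suc)) (∏-factors-degree (X ∘ suc)))
  Δ-update-degree {suc p} X (suc i) = degree-cong moved (degree-scale -1ℤ (Δ-update-degree (X ∘ τ) zero))
    where
    τ = transpose zero (suc i)
    moved : ∀ u → -1ℤ * Δ ((X ∘ τ) [ zero ]≔ u) ≡ Δ (X [ suc i ]≔ u)
    moved u = begin
      -1ℤ * Δ ((X ∘ τ) [ zero ]≔ u)       ≡⟨ ℤₚ.-1*i≡-i _ ⟩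
      - Δ ((X ∘ τ) [ zero ]≔ u)           ≡⟨ Δ-antisym ((X ∘ τ) [ zero ]≔ u) {zero} {suc i} (λ ()) ⟨
      Δ (((X ∘ τ) [ zero ]≔ u) ∘ τ)       ≡⟨ Δ-cong (λ k → sym (begin
        (X [ suc i ]≔ u) k
          ≡⟨ cong₂ (λ a b → (X [ a ]≔ u) b) (transpose-matchˡ zero (suc i)) (transpose-involutive zero (suc i) k) ⟨
        (X [ τ zero ]≔ u) (τ (τ k))          ≡⟨ []≔-∘ (transpose-injective zero (suc i)) X zero u (τ k) ⟩
        ((X ∘ τ) [ zero ]≔ u) (τ k)          ∎)) ⟩
      Δ (X [ suc i ]≔ u)                  ∎
      where open ≡-Reasoning

  lagrange-interpolation : ∀ {p} (X : Fin p → ℤ) → Injective _≡_ _≡_ X → ∀ {G} → DegreeBelow p G → ∀ u →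
                           ∑ (λ i → Δ (X [ i ]≔ u) * G (X i)) ≡ Δ X * G u
  lagrange-interpolation {p} X X-inj {G} G-deg u =
    ℤₚ.i-j≡0⇒i≡j _ _ (degree-roots difference-degree X X-inj vanishes-at-nodes u)
    where
    difference : ℤ → ℤ
    difference u = ∑ (λ i → Δ (X [ i ]≔ u) * G (X i)) - Δ X * G u
    difference-degree : DegreeBelow p difference
    difference-degree = degree-+
      (degree-∑ (λ i v → Δ (X [ i ]≔ v) * G (X i))
        λ i → degree-cong (λ v → ℤₚ.*-comm (G (X i)) _) (degree-scale (G (X i)) (Δ-update-degree X i)))
      (degree-cong (λ u → sym (ℤₚ.neg-distribˡ-* (Δ X) (G u))) (degree-scale (- Δ X) G-deg))
    off-node : ∀ j i → i ≢ j → Δ (X [ i ]≔ X j) * G (X i) ≡ 0ℤ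
    off-node j i i≢j = trans (cong (_* G (X i)) (Δ-repeat (X [ i ]≔ X j) i≢j repeated)) (ℤₚ.*-zeroˡ (G (X i)))
      where repeated = trans (updateAt-updates i X) (sym (updateAt-minimal j i X (i≢j ∘ sym)))
    vanishes-at-nodes : ∀ j → difference (X j) ≡ 0ℤ
    vanishes-at-nodes j = trans (cong (_- Δ X * G (X j)) at-node) (ℤₚ.+-inverseʳ (Δ X * G (X j)))
      where
      at-node : ∑ (λ i → Δ (X [ i ]≔ X j) * G (X i)) ≡ Δ X * G (X j)
      at-node = trans (∑-single _ j (off-node j)) (cong (_* G (X j)) (Δ-cong (updateAt-id-local j X refl)))

  Δ-exchange-≤ : ∀ {p q} (X : Fin p → ℤ) (Y : Fin q → ℤ) → Injective _≡_ _≡_ X → q ℕ.≤ p →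
                 ∑ (λ i → ∑ (λ j → Δ (X [ i ]≔ Y j) * Δ (Y [ j ]≔ X i))) ≡ + q * (Δ X * Δ Y)
  Δ-exchange-≤ {p} {q} X Y X-inj q≤p = begin
    ∑ (λ i → ∑ (λ j → Δ (X [ i ]≔ Y j) * Δ (Y [ j ]≔ X i)))
      ≡⟨ ∑-comm (λ i j → Δ (X [ i ]≔ Y j) * Δ (Y [ j ]≔ X i)) ⟩
    ∑ (λ j → ∑ (λ i → Δ (X [ i ]≔ Y j) * Δ (Y [ j ]≔ X i)))
      ≡⟨ sum-cong-≗ (λ j → lagrange-interpolation X X-inj (degree-mono q≤p (Δ-update-degree Y j)) (Y j)) ⟩
    ∑ (λ j → Δ X * Δ (Y [ j ]≔ Y j))
      ≡⟨ sum-cong-≗ (λ j → cong (Δ X *_) (Δ-cong (updateAt-id-local j Y refl))) ⟩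
    ∑ {q} (λ _ → Δ X * Δ Y)
      ≡⟨ ∑-const q _ ⟩
    + q * (Δ X * Δ Y) ∎
    where open ≡-Reasoning

  Δ-exchange : ∀ {p q} (X : Fin p → ℤ) (Y : Fin q → ℤ) → Injective _≡_ _≡_ X → Injective _≡_ _≡_ Y →
               ∑ (λ i → ∑ (λ j → Δ (X [ i ]≔ Y j) * Δ (Y [ j ]≔ X i))) ≡ + (p ⊓ q) * (Δ X * Δ Y)
  Δ-exchange {p} {q} X Y X-inj Y-inj with ℕₚ.≤-total q p
  ... | inj₁ q≤p =
    trans (Δ-exchange-≤ X Y X-inj q≤p) (cong (λ m → + m * (Δ X * Δ Y)) (sym (ℕₚ.m≥n⇒m⊓n≡n q≤p)))
  ... | inj₂ p≤q = begin
    ∑ (λ i → ∑ (λ j → Δ (X [ i ]≔ Y j) * Δ (Y [ j ]≔ X i)))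
      ≡⟨ ∑-comm (λ i j → Δ (X [ i ]≔ Y j) * Δ (Y [ j ]≔ X i)) ⟩
    ∑ (λ j → ∑ (λ i → Δ (X [ i ]≔ Y j) * Δ (Y [ j ]≔ X i)))
      ≡⟨ sum-cong-≗ (λ j → sum-cong-≗ (λ i → ℤₚ.*-comm (Δ (X [ i ]≔ Y j)) _)) ⟩
    ∑ (λ j → ∑ (λ i → Δ (Y [ j ]≔ X i) * Δ (X [ i ]≔ Y j)))
      ≡⟨ Δ-exchange-≤ Y X Y-inj p≤q ⟩
    + p * (Δ Y * Δ X)
      ≡⟨ cong₂ (λ m x → + m * x) (ℕₚ.m≤n⇒m⊓n≡m p≤q) (ℤₚ.*-comm (Δ X) (Δ Y)) ⟨
    + (p ⊓ q) * (Δ X * Δ Y) ∎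
    where open ≡-Reasoning

  -- Specht polynomials

  -- The Specht polynomial of the shape with column lengths hs: one block of consecutive
  -- variables per column.
  specht : ∀ hs → (Fin (sum hs) → ℤ) → ℤ
  specht []       z = 1ℤ
  specht (h ∷ hs) z = Δ (z ∘ (_↑ˡ sum hs)) * specht hs (z ∘ (h ↑ʳ_))

  specht-cong : ∀ hs {z w : Fin (sum hs) → ℤ} → (∀ k → z k ≡ w k) → specht hs z ≡ specht hs w
  specht-cong []       z≗w = refl
  specht-cong (h ∷ hs) z≗w = cong₂ _*_ (Δ-cong (z≗w ∘ (_↑ˡ sum hs))) (specht-cong hs (z≗w ∘ (h ↑ʳ_)))

  specht-nonzero : ∀ hs (z : Fin (sum hs) → ℤ) → Injective _≡_ _≡_ z → specht hs z ≢ 0ℤ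
  specht-nonzero []       z z-inj ()
  specht-nonzero (h ∷ hs) z z-inj eq with ℤₚ.i*j≡0⇒i≡0∨j≡0 (Δ (z ∘ (_↑ˡ sum hs))) eq
  ... | inj₁ Δ≡0 = Δ-nonzero _ (↑ˡ-injective (sum hs) _ _ ∘ z-inj) Δ≡0
  ... | inj₂ rest≡0 = specht-nonzero hs _ (↑ʳ-injective h _ _ ∘ z-inj) rest≡0

  module FirstColumn (h : ℕ) (hs : List ℕ) where

    L : Fin h → Fin (h ℕ.+ sum hs)
    L i = i ↑ˡ sum hs

    R : Fin (sum hs) → Fin (h ℕ.+ sum hs)
    R j = h ↑ʳ j

    L-injective : Injective _≡_ _≡_ L
    L-injective = ↑ˡ-injective (sum hs) _ _

    R-injective : Injective _≡_ _≡_ R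
    R-injective = ↑ʳ-injective h _ _

    L≢R : ∀ i j → L i ≢ R j
    L≢R = ↑ˡ≢↑ʳ (sum hs)

    R≢L : ∀ j i → R j ≢ L i
    R≢L j i = L≢R i j ∘ sym

    specht-update-L : ∀ (Y : Fin (h ℕ.+ sum hs) → ℤ) j u →
                      specht (h ∷ hs) (Y [ L j ]≔ u) ≡ Δ ((Y ∘ L) [ j ]≔ u) * specht hs (Y ∘ R)
    specht-update-L Y j u = cong₂ _*_ (Δ-cong ([]≔-∘ L-injective Y j u))
                                      (specht-cong hs λ k → updateAt-minimal (R k) (L j) Y (R≢L k j))

    specht-update-R : ∀ (Y : Fin (h ℕ.+ sum hs) → ℤ) j u →
                      specht (h ∷ hs) (Y [ R j ]≔ u) ≡ Δ (Y ∘ L) * specht hs ((Y ∘ R) [ j ]≔ u)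
    specht-update-R Y j u = cong₂ _*_ (Δ-cong λ k → updateAt-minimal (L k) (R j) Y (L≢R k j))
                                      (specht-cong hs ([]≔-∘ R-injective Y j u))

    specht-transpose-LL : ∀ (z : Fin (h ℕ.+ sum hs) → ℤ) i j →
                          specht (h ∷ hs) (z ∘ transpose (L i) (L j)) ≡ Δ (z ∘ L ∘ transpose i j) * specht hs (z ∘ R)
    specht-transpose-LL z i j = cong₂ _*_ (Δ-cong (cong z ∘ transpose-map L-injective i j))
                                          (specht-cong hs λ k → cong z (transpose-unmatched (R≢L k i) (R≢L k j)))

    specht-transpose-LR : ∀ (z : Fin (h ℕ.+ sum hs) → ℤ) i j →
                          specht (h ∷ hs) (z ∘ transpose (L i) (R j)) ≡
                            Δ ((z ∘ L) [ i ]≔ z (R j)) * specht hs ((z ∘ R) [ j ]≔ z (L i))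
    specht-transpose-LR z i j = cong₂ _*_ (Δ-cong (transpose-across L-injective L≢R z i j))
      (specht-cong hs λ k → trans (cong z (transpose-comm (L i) (R j) (R k))) (transpose-across R-injective R≢L z j i k))

    specht-transpose-RR : ∀ (z : Fin (h ℕ.+ sum hs) → ℤ) i j →
                          specht (h ∷ hs) (z ∘ transpose (R i) (R j)) ≡ Δ (z ∘ L) * specht hs (z ∘ R ∘ transpose i j)
    specht-transpose-RR z i j = cong₂ _*_ (Δ-cong λ k → cong z (transpose-unmatched (L≢R k i) (L≢R k j)))
                                          (specht-cong hs (cong z ∘ transpose-map R-injective i j))

  crossMin : ℕ → List ℕ → ℕ
  crossMin h hs = sum (map (h ⊓_) hs)

  -- For column lengths listed in decreasing order this is twice the content
  -- (sum over cells of column index minus row index) of the Young diagram.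
  doubledContent : List ℕ → ℤ
  doubledContent []       = 0ℤ
  doubledContent (h ∷ hs) = doubledContent hs + + 2 * + crossMin h hs - + h * (+ h - 1ℤ)

  specht-exchange : ∀ {h} (X : Fin h → ℤ) → Injective _≡_ _≡_ X →
                    ∀ hs (Y : Fin (sum hs) → ℤ) → Injective _≡_ _≡_ Y →
                    ∑ (λ i → ∑ (λ j → Δ (X [ i ]≔ Y j) * specht hs (Y [ j ]≔ X i))) ≡
                      + crossMin h hs * (Δ X * specht hs Y)
  specht-exchange {h} X X-inj [] Y Y-inj = trans (∑-zero {h} {λ _ → 0ℤ} λ _ → refl) (sym (ℤₚ.*-zeroˡ (Δ X * 1ℤ)))
  specht-exchange {h} X X-inj (h₁ ∷ hs) Y Y-inj = begin
    ∑ (λ i → ∑ (λ j → T i j))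
      ≡⟨ trans (sum-cong-≗ λ i → ∑-↑ h₁ (T i))
               (∑-distrib-+ (λ i → ∑ (λ j → T i (L j))) (λ i → ∑ (λ j → T i (R j)))) ⟩
    ∑ (λ i → ∑ (λ j → T i (L j))) + ∑ (λ i → ∑ (λ j → T i (R j)))
      ≡⟨ cong₂ _+_ first-column other-columns ⟩
    + (h ⊓ h₁) * (Δ X * Δ Y₁) * F + Δ Y₁ * (+ crossMin h hs * (Δ X * F))
      ≡⟨ collect (+ (h ⊓ h₁)) (+ crossMin h hs) (Δ X) (Δ Y₁) F ⟩
    (+ (h ⊓ h₁) + + crossMin h hs) * (Δ X * (Δ Y₁ * F))
      ≡⟨ cong (_* (Δ X * (Δ Y₁ * F))) (ℤₚ.pos-+ (h ⊓ h₁) (crossMin h hs)) ⟨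
    + crossMin h (h₁ ∷ hs) * (Δ X * specht (h₁ ∷ hs) Y) ∎
    where
    open ≡-Reasoning
    open FirstColumn h₁ hs
    Y₁ = Y ∘ L
    Y′ = Y ∘ R
    F = specht hs Y′
    T : Fin h → Fin (h₁ ℕ.+ sum hs) → ℤ
    T i j = Δ (X [ i ]≔ Y j) * specht (h₁ ∷ hs) (Y [ j ]≔ X i)
    first-column : ∑ (λ i → ∑ (λ j → T i (L j))) ≡ + (h ⊓ h₁) * (Δ X * Δ Y₁) * F
    first-column = begin
      ∑ (λ i → ∑ (λ j → T i (L j)))
        ≡⟨ sum-cong-≗ (λ i → sum-cong-≗ λ j → trans (cong (Δ (X [ i ]≔ Y₁ j) *_) (specht-update-L Y j (X i)))
                                                     (sym (ℤₚ.*-assoc (Δ (X [ i ]≔ Y₁ j)) (Δ (Y₁ [ j ]≔ X i)) F))) ⟩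
      ∑ (λ i → ∑ (λ j → Δ (X [ i ]≔ Y₁ j) * Δ (Y₁ [ j ]≔ X i) * F))
        ≡⟨ ∑∑-*ʳ F (λ i j → Δ (X [ i ]≔ Y₁ j) * Δ (Y₁ [ j ]≔ X i)) ⟩
      ∑ (λ i → ∑ (λ j → Δ (X [ i ]≔ Y₁ j) * Δ (Y₁ [ j ]≔ X i))) * F
        ≡⟨ cong (_* F) (Δ-exchange X Y₁ X-inj (L-injective ∘ Y-inj)) ⟩
      + (h ⊓ h₁) * (Δ X * Δ Y₁) * F ∎
    pull : ∀ a b c → a * (b * c) ≡ b * (a * c)
    pull = solve-∀
    other-columns : ∑ (λ i → ∑ (λ j → T i (R j))) ≡ Δ Y₁ * (+ crossMin h hs * (Δ X * F))
    other-columns = begin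
      ∑ (λ i → ∑ (λ j → T i (R j)))
        ≡⟨ sum-cong-≗ (λ i → sum-cong-≗ λ j → trans (cong (Δ (X [ i ]≔ Y′ j) *_) (specht-update-R Y j (X i)))
                                                     (pull (Δ (X [ i ]≔ Y′ j)) (Δ Y₁) (specht hs (Y′ [ j ]≔ X i)))) ⟩
      ∑ (λ i → ∑ (λ j → Δ Y₁ * (Δ (X [ i ]≔ Y′ j) * specht hs (Y′ [ j ]≔ X i))))
        ≡⟨ ∑∑-*ˡ (Δ Y₁) (λ i j → Δ (X [ i ]≔ Y′ j) * specht hs (Y′ [ j ]≔ X i)) ⟩
      Δ Y₁ * ∑ (λ i → ∑ (λ j → Δ (X [ i ]≔ Y′ j) * specht hs (Y′ [ j ]≔ X i)))
        ≡⟨ cong (Δ Y₁ *_) (specht-exchange X X-inj hs Y′ (R-injective ∘ Y-inj)) ⟩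
      Δ Y₁ * (+ crossMin h hs * (Δ X * F)) ∎
    collect : ∀ m s x y f → m * (x * y) * f + y * (s * (x * f)) ≡ (m + s) * (x * (y * f))
    collect = solve-∀

  specht-transposition-sum : ∀ hs (z : Fin (sum hs) → ℤ) → Injective _≡_ _≡_ z →
    ∑ (λ x → ∑ (λ y → specht hs (z ∘ transpose x y))) ≡ (+ sum hs + doubledContent hs) * specht hs z
  specht-transposition-sum []       z z-inj = refl
  specht-transposition-sum (h ∷ hs) z z-inj = begin
    ∑ (λ x → ∑ (λ y → G x y))
      ≡⟨ ∑∑-↑ h N G ⟩
    (∑ (λ i → ∑ (λ j → G (L i) (L j))) + ∑ (λ i → ∑ (λ j → G (L i) (R j)))) +
    (∑ (λ i → ∑ (λ j → G (R i) (L j))) + ∑ (λ i → ∑ (λ j → G (R i) (R j))))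
      ≡⟨ cong₂ _+_ (cong₂ _+_ within-first first-rest) (cong₂ _+_ rest-first within-rest) ⟩
    (+ h * ((+ 2 - + h) * Δ X) * F + + crossMin h hs * (Δ X * F)) +
    (+ crossMin h hs * (Δ X * F) + Δ X * ((+ N + doubledContent hs) * F))
      ≡⟨ collect (+ h) (+ N) (+ crossMin h hs) (doubledContent hs) (Δ X) F ⟩
    ((+ h + + N) + (doubledContent hs + + 2 * + crossMin h hs - + h * (+ h - 1ℤ))) * (Δ X * F)
      ≡⟨ cong (λ m → (m + doubledContent (h ∷ hs)) * (Δ X * F)) (ℤₚ.pos-+ h N) ⟨
    (+ sum (h ∷ hs) + doubledContent (h ∷ hs)) * specht (h ∷ hs) z ∎
    where
    open ≡-Reasoning
    open FirstColumn h hs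
    N = sum hs
    G : Fin (h ℕ.+ N) → Fin (h ℕ.+ N) → ℤ
    G x y = specht (h ∷ hs) (z ∘ transpose x y)
    X = z ∘ L
    Y = z ∘ R
    F = specht hs Y
    within-first : ∑ (λ i → ∑ (λ j → G (L i) (L j))) ≡ + h * ((+ 2 - + h) * Δ X) * F
    within-first = begin
      ∑ (λ i → ∑ (λ j → G (L i) (L j)))              ≡⟨ sum-cong-≗ (λ i → sum-cong-≗ (specht-transpose-LL z i)) ⟩
      ∑ (λ i → ∑ (λ j → Δ (X ∘ transpose i j) * F))  ≡⟨ ∑∑-*ʳ F (λ i j → Δ (X ∘ transpose i j)) ⟩
      ∑ (λ i → ∑ (λ j → Δ (X ∘ transpose i j))) * F  ≡⟨ cong (_* F) (sum-cong-≗ (Δ-transposition-row X)) ⟩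
      ∑ {h} (λ _ → (+ 2 - + h) * Δ X) * F            ≡⟨ cong (_* F) (∑-const h _) ⟩
      + h * ((+ 2 - + h) * Δ X) * F                  ∎
    first-rest : ∑ (λ i → ∑ (λ j → G (L i) (R j))) ≡ + crossMin h hs * (Δ X * F)
    first-rest = trans (sum-cong-≗ λ i → sum-cong-≗ (specht-transpose-LR z i))
                       (specht-exchange X (L-injective ∘ z-inj) hs Y (R-injective ∘ z-inj))
    rest-first : ∑ (λ i → ∑ (λ j → G (R i) (L j))) ≡ + crossMin h hs * (Δ X * F)
    rest-first = begin
      ∑ (λ i → ∑ (λ j → G (R i) (L j)))
        ≡⟨ sum-cong-≗ (λ i → sum-cong-≗ λ j → specht-cong (h ∷ hs) (cong z ∘ transpose-comm (R i) (L j))) ⟩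
      ∑ (λ i → ∑ (λ j → G (L j) (R i)))  ≡⟨ ∑-comm (λ i j → G (L j) (R i)) ⟩
      ∑ (λ j → ∑ (λ i → G (L j) (R i)))  ≡⟨ first-rest ⟩
      + crossMin h hs * (Δ X * F)        ∎
    within-rest : ∑ (λ i → ∑ (λ j → G (R i) (R j))) ≡ Δ X * ((+ N + doubledContent hs) * F)
    within-rest = begin
      ∑ (λ i → ∑ (λ j → G (R i) (R j)))
        ≡⟨ sum-cong-≗ (λ i → sum-cong-≗ (specht-transpose-RR z i)) ⟩
      ∑ (λ i → ∑ (λ j → Δ X * specht hs (Y ∘ transpose i j)))
        ≡⟨ ∑∑-*ˡ (Δ X) (λ i j → specht hs (Y ∘ transpose i j)) ⟩
      Δ X * ∑ (λ i → ∑ (λ j → specht hs (Y ∘ transpose i j)))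
        ≡⟨ cong (Δ X *_) (specht-transposition-sum hs Y (R-injective ∘ z-inj)) ⟩
      Δ X * ((+ N + doubledContent hs) * F)                     ∎
    collect : ∀ h n c d x f → (h * ((+ 2 - h) * x) * f + c * (x * f)) + (c * (x * f) + x * ((n + d) * f)) ≡
                              ((h + n) + (d + + 2 * c - h * (h - 1ℤ))) * (x * f)
    collect = solve-∀

  -- Eigenvectors of Cay(S_n, T_n)

  sumℤ-++ : ∀ xs ys → sumℤ (xs ++ ys) ≡ sumℤ xs + sumℤ ys
  sumℤ-++ []       ys = sym (ℤₚ.+-identityˡ (sumℤ ys))
  sumℤ-++ (x ∷ xs) ys = trans (cong (_+_ x) (sumℤ-++ xs ys)) (sym (ℤₚ.+-assoc x (sumℤ xs) (sumℤ ys)))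

  sumℤ-filter : ∀ {A : Set} {P : Pred A 0ℓ} (P? : Decidable P) (f : A → ℤ) xs →
                sumℤ (map f (filter P? xs)) ≡ sumℤ (map (λ x → if does (P? x) then f x else 0ℤ) xs)
  sumℤ-filter P? f []       = refl
  sumℤ-filter P? f (x ∷ xs) with does (P? x)
  ... | true  = cong (_+_ (f x)) (sumℤ-filter P? f xs)
  ... | false = trans (sumℤ-filter P? f xs) (sym (ℤₚ.+-identityˡ _))

  sumℤ-cartesianProduct : ∀ {A B : Set} (f : A × B → ℤ) xs ys →
    sumℤ (map f (cartesianProduct xs ys)) ≡ sumℤ (map (λ x → sumℤ (map (λ y → f (x , y)) ys)) xs)
  sumℤ-cartesianProduct f []       ys = refl
  sumℤ-cartesianProduct f (x ∷ xs) ys = begin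
    sumℤ (map f (map (x ,_) ys ++ cartesianProduct xs ys))
      ≡⟨ cong sumℤ (Listₚ.map-++ f (map (x ,_) ys) (cartesianProduct xs ys)) ⟩
    sumℤ (map f (map (x ,_) ys) ++ map f (cartesianProduct xs ys))
      ≡⟨ sumℤ-++ (map f (map (x ,_) ys)) _ ⟩
    sumℤ (map f (map (x ,_) ys)) + sumℤ (map f (cartesianProduct xs ys))
      ≡⟨ cong₂ _+_ (cong sumℤ (sym (Listₚ.map-∘ ys))) (sumℤ-cartesianProduct f xs ys) ⟩
    sumℤ (map (λ x → sumℤ (map (λ y → f (x , y)) ys)) (x ∷ xs)) ∎
    where open ≡-Reasoning

  sumℤ-tabulate : ∀ {n} (f : Fin n → ℤ) → sumℤ (tabulate f) ≡ ∑ f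
  sumℤ-tabulate {zero}  f = refl
  sumℤ-tabulate {suc n} f = cong (_+_ (f zero)) (sumℤ-tabulate (f ∘ suc))

  sumℤ-allFin : ∀ n (f : Fin n → ℤ) → sumℤ (map f (allFin n)) ≡ ∑ f
  sumℤ-allFin n f = trans (cong sumℤ (Listₚ.map-tabulate (λ i → i) f)) (sumℤ-tabulate f)

  upper : ∀ {n} → (Fin n → Fin n → ℤ) → Fin n → Fin n → ℤ
  upper f i j = if does (toℕ i <? toℕ j) then f i j else 0ℤ

  pairSum : ∀ {n} → (Fin n → Fin n → ℤ) → ℤ
  pairSum f = ∑ (λ i → ∑ (λ j → upper f i j))

  sumℤ-transpositions : ∀ {n} (f : Fin n → Fin n → ℤ) →
                        sumℤ (map (λ (i , j) → f i j) (transpositions n)) ≡ pairSum f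
  sumℤ-transpositions {n} f = begin
    sumℤ (map (λ (i , j) → f i j) (transpositions n))
      ≡⟨ sumℤ-filter (λ (i , j) → toℕ i <? toℕ j) (λ (i , j) → f i j) (cartesianProduct (allFin n) (allFin n)) ⟩
    sumℤ (map (λ (i , j) → upper f i j) (cartesianProduct (allFin n) (allFin n)))
      ≡⟨ sumℤ-cartesianProduct (λ (i , j) → upper f i j) (allFin n) (allFin n) ⟩
    sumℤ (map (λ i → sumℤ (map (upper f i) (allFin n))) (allFin n))
      ≡⟨ trans (sumℤ-allFin n _) (sum-cong-≗ λ i → sumℤ-allFin n (upper f i)) ⟩
    ∑ (λ i → ∑ (λ j → upper f i j)) ∎
    where open ≡-Reasoning

  diagonal : ∀ {n} → (Fin n → Fin n → ℤ) → Fin n → Fin n → ℤ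
  diagonal f i j = if does (i ≟ j) then f i j else 0ℤ

  symmetric-split : ∀ {n} (f : Fin n → Fin n → ℤ) → (∀ i j → f i j ≡ f j i) → ∀ i j →
                    f i j ≡ (upper f i j + upper f j i) + diagonal f i j
  symmetric-split f f-sym i j with ℕₚ.<-cmp (toℕ i) (toℕ j)
  ... | tri< i<j _ j≮i
    rewrite dec-true (toℕ i <? toℕ j) i<j | dec-false (toℕ j <? toℕ i) j≮i
          | dec-false (i ≟ j) (λ i≡j → ℕₚ.<-irrefl (cong toℕ i≡j) i<j)
    = sym (trans (ℤₚ.+-identityʳ _) (ℤₚ.+-identityʳ _))
  ... | tri≈ i≮j i≡j _ rewrite toℕ-injective i≡j | dec-false (toℕ j <? toℕ j) i≮j | dec-true (j ≟ j) refl
    = sym (ℤₚ.+-identityˡ _)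
  ... | tri> i≮j _ j<i
    rewrite dec-false (toℕ i <? toℕ j) i≮j | dec-true (toℕ j <? toℕ i) j<i
          | dec-false (i ≟ j) (λ i≡j → ℕₚ.<-irrefl (cong toℕ (sym i≡j)) j<i)
    = trans (f-sym i j) (sym (trans (ℤₚ.+-identityʳ _) (ℤₚ.+-identityˡ _)))

  ∑∑-symmetric : ∀ {n} (f : Fin n → Fin n → ℤ) → (∀ i j → f i j ≡ f j i) →
                 ∑ (λ i → ∑ (λ j → f i j)) ≡ (pairSum f + pairSum f) + ∑ (λ i → f i i)
  ∑∑-symmetric f f-sym = begin
    ∑ (λ i → ∑ (λ j → f i j))
      ≡⟨ sum-cong-≗ (λ i → sum-cong-≗ (symmetric-split f f-sym i)) ⟩
    ∑ (λ i → ∑ (λ j → (upper f i j + upper f j i) + diagonal f i j))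
      ≡⟨ trans (∑∑-distrib-+ (λ i j → upper f i j + upper f j i) (diagonal f))
               (cong (_+ ∑ (λ i → ∑ (diagonal f i))) (∑∑-distrib-+ (upper f) (λ i j → upper f j i))) ⟩
    (∑ (λ i → ∑ (λ j → upper f i j)) + ∑ (λ i → ∑ (λ j → upper f j i))) + ∑ (λ i → ∑ (diagonal f i))
      ≡⟨ cong₂ (λ a b → (∑ (λ i → ∑ (λ j → upper f i j)) + a) + b)
               (∑-comm (λ i j → upper f j i))
               (sum-cong-≗ λ i → trans (∑-single (diagonal f i) i (off-diagonal i)) (on-diagonal i)) ⟩
    (∑ (λ i → ∑ (λ j → upper f i j)) + ∑ (λ j → ∑ (λ i → upper f j i))) + ∑ (λ i → f i i) ∎
    where
    open ≡-Reasoning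
    off-diagonal : ∀ i j → j ≢ i → diagonal f i j ≡ 0ℤ
    off-diagonal i j j≢i rewrite dec-false (i ≟ j) (j≢i ∘ sym) = refl
    on-diagonal : ∀ i → diagonal f i i ≡ f i i
    on-diagonal i rewrite dec-true (i ≟ i) refl = refl

  swapThen-perm : ∀ {n} (g : Vec (Fin n) n) → IsPerm g → ∀ i j → IsPerm (swapThen (i , j) g)
  swapThen-perm g g-perm i j p q e =
    g-perm p q (transpose-injective i j (trans (sym (lookup-map p (transpose i j) g)) (trans e (lookup-map q (transpose i j) g))))

  -- g⁻¹ v; the fallback value is junk, since permutations are surjective (lookup-position).
  position : ∀ {n} → Vec (Fin n) n → Fin n → Fin n
  position g v with any? (λ p → lookup g p ≟ v)
  ... | yes (p , _) = p
  ... | no _        = v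

  lookup-position : ∀ {n} (g : Vec (Fin n) n) → IsPerm g → ∀ v → lookup g (position g v) ≡ v
  lookup-position {suc m} g g-perm v with any? (λ p → lookup g p ≟ v)
  ... | yes (p , gp≡v) = gp≡v
  ... | no ∄p = contradiction (injective⇒≤ squeeze-injective) ℕₚ.1+n≰n
    where
    squeeze : Fin (suc m) → Fin m
    squeeze p = punchOut {i = v} (λ v≡gp → ∄p (p , sym v≡gp))
    squeeze-injective : Injective _≡_ _≡_ squeeze
    squeeze-injective {p} {q} e =
      g-perm p q (punchOut-injective (λ v≡gp → ∄p (p , sym v≡gp)) (λ v≡gq → ∄p (q , sym v≡gq)) e)

  position-injective : ∀ {n} (g : Vec (Fin n) n) → IsPerm g → Injective _≡_ _≡_ (position g)
  position-injective g g-perm {v} {w} e =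
    trans (sym (lookup-position g g-perm v)) (trans (cong (lookup g) e) (lookup-position g g-perm w))

  position-swapThen : ∀ {n} (g : Vec (Fin n) n) → IsPerm g → ∀ i j v →
                      position (swapThen (i , j) g) v ≡ position g (transpose i j v)
  position-swapThen g g-perm i j v = swapThen-perm g g-perm i j _ _ (begin
    lookup (swapThen (i , j) g) (position (swapThen (i , j) g) v)
      ≡⟨ lookup-position (swapThen (i , j) g) (swapThen-perm g g-perm i j) v ⟩
    v                                                               ≡⟨ transpose-involutive i j v ⟨
    transpose i j (transpose i j v)                                 ≡⟨ cong (transpose i j) (lookup-position g g-perm _) ⟨
    transpose i j (lookup g (position g (transpose i j v)))         ≡⟨ lookup-map _ (transpose i j) g ⟨
    lookup (swapThen (i , j) g) (position g (transpose i j v))      ∎)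
    where open ≡-Reasoning

  coordinates : ∀ {n} → Vec (Fin n) n → Fin n → ℤ
  coordinates g v = + toℕ (position g v)

  coordinates-injective : ∀ {n} (g : Vec (Fin n) n) → IsPerm g → Injective _≡_ _≡_ (coordinates g)
  coordinates-injective g g-perm = position-injective g g-perm ∘ toℕ-injective ∘ ℤₚ.+-injective

  spechtVector : ∀ hs → Vec (Fin (sum hs)) (sum hs) → ℤ
  spechtVector hs g = specht hs (coordinates g)

  adjAct-spechtVector : ∀ hs g → IsPerm g →
    adjAct (spechtVector hs) g ≡ pairSum (λ i j → specht hs (coordinates g ∘ transpose i j))
  adjAct-spechtVector hs g g-perm =
    trans (cong sumℤ (Listₚ.map-cong moved (transpositions (sum hs))))
          (sumℤ-transpositions (λ i j → specht hs (coordinates g ∘ transpose i j)))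
    where
    moved : ∀ ((i , j) : Fin (sum hs) × Fin (sum hs)) →
            spechtVector hs (swapThen (i , j) g) ≡ specht hs (coordinates g ∘ transpose i j)
    moved (i , j) = specht-cong hs (cong (+_ ∘ toℕ) ∘ position-swapThen g g-perm i j)

  specht-pairSum : ∀ hs (z : Fin (sum hs) → ℤ) → Injective _≡_ _≡_ z →
                   let W = pairSum (λ i j → specht hs (z ∘ transpose i j)) in
                   (W + W) + + sum hs * specht hs z ≡ (+ sum hs + doubledContent hs) * specht hs z
  specht-pairSum hs z z-inj = begin
    (pairSum f + pairSum f) + + sum hs * specht hs z   ≡⟨ cong (_+_ (pairSum f + pairSum f)) diagonal-sum ⟨
    (pairSum f + pairSum f) + ∑ (λ i → f i i)
      ≡⟨ ∑∑-symmetric f (λ i j → specht-cong hs (cong z ∘ transpose-comm i j)) ⟨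
    ∑ (λ i → ∑ (λ j → f i j))                          ≡⟨ specht-transposition-sum hs z z-inj ⟩
    (+ sum hs + doubledContent hs) * specht hs z       ∎
    where
    open ≡-Reasoning
    f : Fin (sum hs) → Fin (sum hs) → ℤ
    f i j = specht hs (z ∘ transpose i j)
    diagonal-sum : ∑ (λ i → f i i) ≡ + sum hs * specht hs z
    diagonal-sum = trans (sum-cong-≗ λ i → specht-cong hs (cong z ∘ transpose-same i)) (∑-const (sum hs) (specht hs z))

  column-eigenvalue : ∀ hs k → doubledContent hs ≡ + 2 * k → IsEigenvalue (sum hs) k
  column-eigenvalue hs k dc≡2k = spechtVector hs , (Vec.allFin n , identity-perm , nonzero) , eigen
    where
    n = sum hs
    identity-perm : IsPerm (Vec.allFin n)
    identity-perm i j e = trans (sym (lookup-allFin i)) (trans e (lookup-allFin j))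
    nonzero : spechtVector hs (Vec.allFin n) ≢ 0ℤ
    nonzero = specht-nonzero hs _ (coordinates-injective _ identity-perm)
    halve : ∀ w n f k → (w + w) + n * f ≡ (n + + 2 * k) * f → w * + 2 ≡ k * f * + 2
    halve w n f k e = begin
      w * + 2                          ≡⟨ double w n f ⟩
      ((w + w) + n * f) - n * f        ≡⟨ cong (_- n * f) e ⟩
      (n + + 2 * k) * f - n * f        ≡⟨ cancel n k f ⟩
      k * f * + 2                      ∎
      where
      open ≡-Reasoning
      double : ∀ w n f → w * + 2 ≡ ((w + w) + n * f) - n * f
      double = solve-∀
      cancel : ∀ n k f → (n + + 2 * k) * f - n * f ≡ k * f * + 2
      cancel = solve-∀
    eigen : ∀ g → IsPerm g → adjAct (spechtVector hs) g ≡ k * spechtVector hs g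
    eigen g g-perm = ℤₚ.*-cancelʳ-≡ _ _ (+ 2) (trans (cong (_* + 2) (adjAct-spechtVector hs g g-perm))
      (halve W (+ n) (spechtVector hs g) k
        (trans (specht-pairSum hs (coordinates g) (coordinates-injective g g-perm))
               (cong (λ c → (+ n + c) * spechtVector hs g) dc≡2k))))
      where W = pairSum (λ i j → specht hs (coordinates g ∘ transpose i j))

  -- Content of shapes

  choose-2 : ∀ w → + w * (+ w - 1ℤ) ≡ + 2 * + (w C 2)
  choose-2 zero    = refl
  choose-2 (suc w) = begin
    + suc w * (+ suc w - 1ℤ)               ≡⟨ cong (λ x → x * (x - 1ℤ)) (ℤₚ.pos-+ 1 w) ⟩
    (1ℤ + + w) * ((1ℤ + + w) - 1ℤ)          ≡⟨ pascal (+ w) ⟩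
    + 2 * + w + + w * (+ w - 1ℤ)            ≡⟨ cong (_+_ (+ 2 * + w)) (choose-2 w) ⟩
    + 2 * + w + + 2 * + (w C 2)             ≡⟨ ℤₚ.*-distribˡ-+ (+ 2) (+ w) (+ (w C 2)) ⟨
    + 2 * (+ w + + (w C 2))                 ≡⟨ cong (+ 2 *_) (ℤₚ.pos-+ w (w C 2)) ⟨
    + 2 * + (w ℕ.+ w C 2)                   ≡⟨ cong (λ x → + 2 * + (x ℕ.+ w C 2)) (nC1≡n w) ⟨
    + 2 * + (w C 1 ℕ.+ w C 2)               ≡⟨ cong (λ x → + 2 * + x) (nCk+nC[k+1]≡[n+1]C[k+1] w 1) ⟩
    + 2 * + (suc w C 2)                     ∎
    where
    open ≡-Reasoning
    pascal : ∀ w → (1ℤ + w) * ((1ℤ + w) - 1ℤ) ≡ + 2 * w + w * (w - 1ℤ)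
    pascal = solve-∀

  -- Column lengths of the shape obtained by putting a row of length (length hs + q) on top.
  addRow : ℕ → List ℕ → List ℕ
  addRow q hs = map suc hs ++ replicate q 1

  -- Column lengths of the shape obtained from μ by adding a first column and a first row,
  -- both of length (width of μ) + l + 1.
  frame : ℕ → List ℕ → List ℕ
  frame l μs = addRow l (length μs ℕ.+ l ∷ μs)

  length-addRow : ∀ q hs → length (addRow q hs) ≡ length hs ℕ.+ q
  length-addRow q hs =
    trans (Listₚ.length-++ (map suc hs)) (cong₂ ℕ._+_ (Listₚ.length-map suc hs) (Listₚ.length-replicate q))

  sum-replicate-1 : ∀ q → sum (replicate q 1) ≡ q
  sum-replicate-1 zero    = refl
  sum-replicate-1 (suc q) = cong suc (sum-replicate-1 q)

  sum-addRow : ∀ q hs → sum (addRow q hs) ≡ sum hs ℕ.+ (length hs ℕ.+ q)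
  sum-addRow q []       = sum-replicate-1 q
  sum-addRow q (h ∷ hs) = trans (cong (suc h ℕ.+_) (sum-addRow q hs)) (regroup h (sum hs) (length hs ℕ.+ q))
    where
    regroup : ∀ a b c → suc a ℕ.+ (b ℕ.+ c) ≡ (a ℕ.+ b) ℕ.+ suc c
    regroup = ℕ-Solver.solve-∀

  crossMin-replicate-1 : ∀ h q → crossMin (suc h) (replicate q 1) ≡ q
  crossMin-replicate-1 h zero    = refl
  crossMin-replicate-1 h (suc q) = cong₂ (λ a b → suc a ℕ.+ b) (ℕₚ.⊓-zeroʳ h) (crossMin-replicate-1 h q)

  crossMin-addRow : ∀ h q hs → crossMin (suc h) (addRow q hs) ≡ crossMin h hs ℕ.+ (length hs ℕ.+ q)
  crossMin-addRow h q []       = crossMin-replicate-1 h q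
  crossMin-addRow h q (x ∷ xs) =
    trans (cong (suc (h ⊓ x) ℕ.+_) (crossMin-addRow h q xs)) (regroup (h ⊓ x) (crossMin h xs) (length xs ℕ.+ q))
    where
    regroup : ∀ a b c → suc a ℕ.+ (b ℕ.+ c) ≡ (a ℕ.+ b) ℕ.+ suc c
    regroup = ℕ-Solver.solve-∀

  crossMin-dominated : ∀ {h hs} → All (ℕ._≤ h) hs → crossMin h hs ≡ sum hs
  crossMin-dominated []           = refl
  crossMin-dominated (x≤h ∷ xs≤h) = cong₂ ℕ._+_ (ℕₚ.m≥n⇒m⊓n≡n x≤h) (crossMin-dominated xs≤h)

  doubledContent-replicate-1 : ∀ q → doubledContent (replicate q 1) ≡ + q * (+ q - 1ℤ)
  doubledContent-replicate-1 zero    = refl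
  doubledContent-replicate-1 (suc q) = begin
    doubledContent (replicate q 1) + + 2 * + crossMin 1 (replicate q 1) - 1ℤ * (1ℤ - 1ℤ)
      ≡⟨ cong₂ (λ c m → c + + 2 * + m - 1ℤ * (1ℤ - 1ℤ)) (doubledContent-replicate-1 q) (crossMin-replicate-1 0 q) ⟩
    + q * (+ q - 1ℤ) + + 2 * + q - 1ℤ * (1ℤ - 1ℤ)   ≡⟨ one-more (+ q) ⟩
    (1ℤ + + q) * ((1ℤ + + q) - 1ℤ)                   ≡⟨ cong (λ x → x * (x - 1ℤ)) (ℤₚ.pos-+ 1 q) ⟨
    + suc q * (+ suc q - 1ℤ)                         ∎
    where
    open ≡-Reasoning
    one-more : ∀ q → q * (q - 1ℤ) + + 2 * q - 1ℤ * (1ℤ - 1ℤ) ≡ (1ℤ + q) * ((1ℤ + q) - 1ℤ)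
    one-more = solve-∀

  doubledContent-addRow : ∀ q hs → let w = length hs ℕ.+ q in
    doubledContent (addRow q hs) ≡ doubledContent hs - + 2 * + sum hs + + w * (+ w - 1ℤ)
  doubledContent-addRow q []       = trans (doubledContent-replicate-1 q) (sym (ℤₚ.+-identityˡ _))
  doubledContent-addRow q (h ∷ hs) = begin
    doubledContent (addRow q hs) + + 2 * + crossMin (suc h) (addRow q hs) - + suc h * (+ suc h - 1ℤ)
      ≡⟨ cong₂ (λ c m → c + + 2 * + m - + suc h * (+ suc h - 1ℤ)) (doubledContent-addRow q hs) (crossMin-addRow h q hs) ⟩
    (D - + 2 * + S + + w * (+ w - 1ℤ)) + + 2 * + (K ℕ.+ w) - + suc h * (+ suc h - 1ℤ)
      ≡⟨ cong₂ (λ m x → (D - + 2 * + S + + w * (+ w - 1ℤ)) + + 2 * m - x * (x - 1ℤ)) (ℤₚ.pos-+ K w) (ℤₚ.pos-+ 1 h) ⟩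
    (D - + 2 * + S + + w * (+ w - 1ℤ)) + + 2 * (+ K + + w) - (1ℤ + + h) * ((1ℤ + + h) - 1ℤ)
      ≡⟨ regroup D (+ S) (+ K) (+ w) (+ h) ⟩
    (D + + 2 * + K - + h * (+ h - 1ℤ)) - + 2 * (+ h + + S) + (1ℤ + + w) * ((1ℤ + + w) - 1ℤ)
      ≡⟨ cong₂ (λ m x → (D + + 2 * + K - + h * (+ h - 1ℤ)) - + 2 * m + x * (x - 1ℤ)) (ℤₚ.pos-+ h S) (ℤₚ.pos-+ 1 w) ⟨
    doubledContent (h ∷ hs) - + 2 * + sum (h ∷ hs) + + suc w * (+ suc w - 1ℤ)
      ∎
    where
    open ≡-Reasoning
    D = doubledContent hs
    S = sum hs
    K = crossMin h hs
    w = length hs ℕ.+ q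
    regroup : ∀ D S K w h → (D - + 2 * S + w * (w - 1ℤ)) + + 2 * (K + w) - (1ℤ + h) * ((1ℤ + h) - 1ℤ) ≡
                            (D + + 2 * K - h * (h - 1ℤ)) - + 2 * (h + S) + (1ℤ + w) * ((1ℤ + w) - 1ℤ)
    regroup = solve-∀

  -- The new row and column carry opposite contents, and μ is moved along the diagonal.
  doubledContent-frame : ∀ l μs → All (ℕ._≤ length μs ℕ.+ l) μs → doubledContent (frame l μs) ≡ doubledContent μs
  doubledContent-frame l μs μs≤r = begin
    doubledContent (addRow l (r ∷ μs))
      ≡⟨ doubledContent-addRow l (r ∷ μs) ⟩
    (doubledContent μs + + 2 * + crossMin r μs - + r * (+ r - 1ℤ)) - + 2 * + (r ℕ.+ sum μs) + + suc r * (+ suc r - 1ℤ)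
      ≡⟨ cong (λ m → (doubledContent μs + + 2 * + m - + r * (+ r - 1ℤ)) - + 2 * + (r ℕ.+ sum μs) + + suc r * (+ suc r - 1ℤ))
              (crossMin-dominated μs≤r) ⟩
    (doubledContent μs + + 2 * + sum μs - + r * (+ r - 1ℤ)) - + 2 * + (r ℕ.+ sum μs) + + suc r * (+ suc r - 1ℤ)
      ≡⟨ cong₂ (λ s x → (doubledContent μs + + 2 * + sum μs - + r * (+ r - 1ℤ)) - + 2 * s + x * (x - 1ℤ))
               (ℤₚ.pos-+ r (sum μs)) (ℤₚ.pos-+ 1 r) ⟩
    (doubledContent μs + + 2 * + sum μs - + r * (+ r - 1ℤ)) - + 2 * (+ r + + sum μs) + (1ℤ + + r) * ((1ℤ + + r) - 1ℤ)
      ≡⟨ cancel (doubledContent μs) (+ sum μs) (+ r) ⟩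
    doubledContent μs ∎
    where
    open ≡-Reasoning
    r = length μs ℕ.+ l
    cancel : ∀ D S r → (D + + 2 * S - r * (r - 1ℤ)) - + 2 * (r + S) + (1ℤ + r) * ((1ℤ + r) - 1ℤ) ≡ D
    cancel = solve-∀

  sum-frame : ∀ l μs → sum (frame l μs) ≡ suc (sum μs ℕ.+ 2 ℕ.* (length μs ℕ.+ l))
  sum-frame l μs = trans (sum-addRow l (r ∷ μs)) (regroup r (sum μs))
    where
    r = length μs ℕ.+ l
    regroup : ∀ r s → (r ℕ.+ s) ℕ.+ suc r ≡ suc (s ℕ.+ 2 ℕ.* r)
    regroup = ℕ-Solver.solve-∀

  -- The frame around the partition (w, ρ), whose content is C(w,2) + content(ρ) - |ρ|.
  frame-eigenvalue : ∀ ρs q l {k d} → let w = length ρs ℕ.+ q in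
    All (_< w) ρs → doubledContent ρs + + 2 * + d ≡ + 2 * + sum ρs → k ℕ.+ d ≡ w C 2 →
    IsEigenvalue (sum (frame l (addRow q ρs))) (+ k)
  frame-eigenvalue ρs q l {k} {d} ρs<w content k+d≡ = column-eigenvalue (frame l μs) (+ k) (begin
    doubledContent (frame l μs)
      ≡⟨ doubledContent-frame l μs μs-fit ⟩
    doubledContent μs
      ≡⟨ doubledContent-addRow q ρs ⟩
    doubledContent ρs - + 2 * + sum ρs + + w * (+ w - 1ℤ)
      ≡⟨ cong₂ (λ s c → doubledContent ρs - s + c) content (sym (choose-2 w)) ⟨
    doubledContent ρs - (doubledContent ρs + + 2 * + d) + + 2 * + (w C 2)
      ≡⟨ cong (λ m → doubledContent ρs - (doubledContent ρs + + 2 * + d) + + 2 * m)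
              (trans (cong +_ (sym k+d≡)) (ℤₚ.pos-+ k d)) ⟩
    doubledContent ρs - (doubledContent ρs + + 2 * + d) + + 2 * (+ k + + d)
      ≡⟨ cancel (doubledContent ρs) (+ k) (+ d) ⟩
    + 2 * + k ∎)
    where
    open ≡-Reasoning
    w = length ρs ℕ.+ q
    μs = addRow q ρs
    ones : ∀ q → All (ℕ._≤ (length ρs ℕ.+ q) ℕ.+ l) (replicate q 1)
    ones zero    = []
    ones (suc q) =
      Allₚ.replicate⁺ (suc q) (subst (λ x → 1 ℕ.≤ x ℕ.+ l) (sym (ℕₚ.+-suc (length ρs) q)) (s≤s z≤n))
    μs-fit : All (ℕ._≤ length μs ℕ.+ l) μs
    μs-fit = subst (λ x → All (ℕ._≤ x ℕ.+ l) μs) (sym (length-addRow q ρs))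
                   (Allₚ.++⁺ (Allₚ.map⁺ (All.map (λ ρ<w → ℕₚ.≤-trans ρ<w (ℕₚ.m≤m+n w l)) ρs<w)) (ones q))
    cancel : ∀ c k d → c - (c + + 2 * d) + + 2 * (k + d) ≡ + 2 * k
    cancel = solve-∀

  framed-row-eigenvalue : ∀ ρs {a s t k d} → length ρs ℕ.≤ a → All (_< a) ρs → sum ρs ≡ suc (2 ℕ.* s) →
                          doubledContent ρs + + 2 * + d ≡ + 2 * + sum ρs → k ℕ.+ d ≡ a C 2 → a ℕ.+ suc s ℕ.≤ t →
                          IsEigenvalue (a ℕ.+ 2 ℕ.* t) (+ k)
  framed-row-eigenvalue ρs {s = s} {k = k} {d} fits short size content binomial threshold
    with ℕₚ.m≤n⇒∃[o]m+o≡n fits | ℕₚ.m≤n⇒∃[o]m+o≡n threshold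
  ... | q , refl | l , refl =
    subst (λ n → IsEigenvalue n (+ k)) cells (frame-eigenvalue ρs q l {k} {d} short content binomial)
    where
    open ≡-Reasoning
    w = length ρs ℕ.+ q
    cells : sum (frame l (addRow q ρs)) ≡ w ℕ.+ 2 ℕ.* (w ℕ.+ suc s ℕ.+ l)
    cells = begin
      sum (frame l (addRow q ρs))                                          ≡⟨ sum-frame l (addRow q ρs) ⟩
      suc (sum (addRow q ρs) ℕ.+ 2 ℕ.* (length (addRow q ρs) ℕ.+ l))
        ≡⟨ cong₂ (λ x y → suc (x ℕ.+ 2 ℕ.* (y ℕ.+ l))) (sum-addRow q ρs) (length-addRow q ρs) ⟩
      suc (sum ρs ℕ.+ w ℕ.+ 2 ℕ.* (w ℕ.+ l))
        ≡⟨ cong (λ x → suc (x ℕ.+ w ℕ.+ 2 ℕ.* (w ℕ.+ l))) size ⟩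
      suc (suc (2 ℕ.* s) ℕ.+ w ℕ.+ 2 ℕ.* (w ℕ.+ l))                               ≡⟨ regroup s w l ⟩
      w ℕ.+ 2 ℕ.* (w ℕ.+ suc s ℕ.+ l)                                             ∎
      where
      regroup : ∀ s w l → suc (suc (2 ℕ.* s) ℕ.+ w ℕ.+ 2 ℕ.* (w ℕ.+ l)) ≡ w ℕ.+ 2 ℕ.* (w ℕ.+ suc s ℕ.+ l)
      regroup = ℕ-Solver.solve-∀

  -- Column lengths of the partition (e + 3, 2, 1^e).
  nearHook : ℕ → List ℕ
  nearHook e = addRow (suc e) (suc e ∷ 1 ∷ [])

  nearHook-content : ∀ e → doubledContent (nearHook e) + + 2 * + (3 ℕ.+ e) ≡ + 2 * + sum (nearHook e)
  nearHook-content e = begin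
    doubledContent (nearHook e) + + 2 * + (3 ℕ.+ e)
      ≡⟨ cong (_+ + 2 * + (3 ℕ.+ e)) (doubledContent-addRow (suc e) column) ⟩
    doubledContent column - + 2 * + sum column + + (3 ℕ.+ e) * (+ (3 ℕ.+ e) - 1ℤ) + + 2 * + (3 ℕ.+ e)
      ≡⟨ cong₂ (λ c s → c - + 2 * s + + (3 ℕ.+ e) * (+ (3 ℕ.+ e) - 1ℤ) + + 2 * + (3 ℕ.+ e)) column-content column-sum ⟩
    (+ 2 - (1ℤ + + e) * ((1ℤ + + e) - 1ℤ)) - + 2 * (+ 2 + + e) + + (3 ℕ.+ e) * (+ (3 ℕ.+ e) - 1ℤ) + + 2 * + (3 ℕ.+ e)
      ≡⟨ cong (λ x → (+ 2 - (1ℤ + + e) * ((1ℤ + + e) - 1ℤ)) - + 2 * (+ 2 + + e) + x * (x - 1ℤ) + + 2 * x) (ℤₚ.pos-+ 3 e) ⟩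
    (+ 2 - (1ℤ + + e) * ((1ℤ + + e) - 1ℤ)) - + 2 * (+ 2 + + e) + (+ 3 + + e) * ((+ 3 + + e) - 1ℤ) + + 2 * (+ 3 + + e)
      ≡⟨ expand (+ e) ⟩
    + 2 * ((+ 2 + + e) + (+ 3 + + e))
      ≡⟨ cong₂ (λ x y → + 2 * (x + y)) column-sum (ℤₚ.pos-+ 3 e) ⟨
    + 2 * (+ sum column + + (3 ℕ.+ e))
      ≡⟨ cong (+ 2 *_) (trans (cong +_ (sum-addRow (suc e) column)) (ℤₚ.pos-+ (sum column) (3 ℕ.+ e))) ⟨
    + 2 * + sum (nearHook e) ∎
    where
    open ≡-Reasoning
    column = suc e ∷ 1 ∷ []
    column-content : doubledContent column ≡ + 2 - (1ℤ + + e) * ((1ℤ + + e) - 1ℤ)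
    column-content =
      cong₂ (λ m x → 0ℤ + + 2 * + m - x * (x - 1ℤ)) (cong (λ x → suc x ℕ.+ 0) (ℕₚ.⊓-zeroʳ e)) (ℤₚ.pos-+ 1 e)
    column-sum : + sum column ≡ + 2 + + e
    column-sum = trans (cong +_ (ℕₚ.+-comm (suc e) 1)) (ℤₚ.pos-+ 2 e)
    expand : ∀ e → (+ 2 - (1ℤ + e) * ((1ℤ + e) - 1ℤ)) - + 2 * (+ 2 + e) + (+ 3 + e) * ((+ 3 + e) - 1ℤ) + + 2 * (+ 3 + e) ≡
                   + 2 * ((+ 2 + e) + (+ 3 + e))
    expand = solve-∀


open import Defs
open import Data.Nat using (ℕ; suc; _+_; _*_; _∸_; _≤_; _<_; _/_; _%_; s≤s; _≟_)
import Data.Nat.Properties as ℕₚ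
open ℕₚ using (module ≤-Reasoning)
import Data.Nat.DivMod as ℕ
open import Data.Nat.Combinatorics using (_C_; nC1≡n; nCk+nC[k+1]≡[n+1]C[k+1])
open import Data.Nat.ListAction using (sum)
open import Data.Nat.Tactic.RingSolver using (solve-∀)
open import Data.Integer using (+_)
open import Data.List using (List; []; _∷_; replicate; length)
open import Data.List.Relation.Unary.All using (All; []; _∷_)
import Data.List.Relation.Unary.All.Properties as Allₚ
open import Data.Product using (∃; _×_; _,_)
open import Data.Sum using (inj₁; inj₂)
open import Data.Unit using (tt)
open import Function using (_∘_)
open import Relation.Binary.PropositionalEquality using (_≡_; refl; sym; trans; cong; subst; module ≡-Reasoning)
open import Relation.Nullary using (yes; no)
open SpechtEigenvectors
  using (column-eigenvalue; addRow; frame-eigenvalue; sum-frame; sum-addRow; length-addRow;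
         framed-row-eigenvalue; nearHook; nearHook-content)

2m≤1+2t⇒m≤t : ∀ {m t} → 2 * m ≤ suc (2 * t) → m ≤ t
2m≤1+2t⇒m≤t {m} {t} 2m≤1+2t = ℕₚ.≮⇒≥ λ t<m → ℕₚ.1+n≰n (begin
  suc (suc (2 * t))  ≡⟨ ℕₚ.*-suc 2 t ⟨
  2 * suc t          ≤⟨ ℕₚ.*-monoʳ-≤ 2 t<m ⟩
  2 * m              ≤⟨ 2m≤1+2t ⟩
  suc (2 * t)        ∎)
  where open ≤-Reasoning

2a≤t+2⇒a+c≤t : ∀ {a t c} → 2 * a ≤ t + 2 → 2 + c ≤ a → a + c ≤ t
2a≤t+2⇒a+c≤t {a} {t} {c} 2a≤t+2 2+c≤a = ℕₚ.+-cancelʳ-≤ 2 (a + c) t (begin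
  a + c + 2    ≡⟨ ℕₚ.+-assoc a c 2 ⟩
  a + (c + 2)  ≡⟨ cong (_+_ a) (ℕₚ.+-comm c 2) ⟩
  a + (2 + c)  ≤⟨ ℕₚ.+-monoʳ-≤ a 2+c≤a ⟩
  a + a        ≡⟨ cong (_+_ a) (ℕₚ.+-identityʳ a) ⟨
  2 * a        ≤⟨ 2a≤t+2 ⟩
  t + 2        ∎)
  where open ≤-Reasoning

27≤a+2t⇒a+c≤t : ∀ {a t c} → 3 * a + 2 * c ≤ 28 → 27 ≤ a + 2 * t → a + c ≤ t
27≤a+2t⇒a+c≤t {a} {t} {c} small 27≤n = 2m≤1+2t⇒m≤t (ℕₚ.+-cancelˡ-≤ a _ _ (begin
  a + 2 * (a + c)   ≡⟨ regroup a c ⟩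
  3 * a + 2 * c     ≤⟨ small ⟩
  28                ≤⟨ s≤s 27≤n ⟩
  suc (a + 2 * t)   ≡⟨ ℕₚ.+-suc a (2 * t) ⟨
  a + suc (2 * t)   ∎))
  where
  open ≤-Reasoning
  regroup : ∀ a c → a + 2 * (a + c) ≡ 3 * a + 2 * c
  regroup = solve-∀

binomial-gap : ∀ {a k} → 1 ≤ a → (a ∸ 1) C 2 + 1 ≤ k → k ≤ a C 2 → ∃ λ d → k + d ≡ a C 2 × 2 + d ≤ a
binomial-gap {suc a} {k} _ lower upper with ℕₚ.m≤n⇒∃[o]m+o≡n upper
... | d , k+d≡ = d , k+d≡ , s≤s (ℕₚ.+-cancelˡ-≤ (a C 2) (suc d) a (begin
  a C 2 + suc d     ≡⟨ ℕₚ.+-assoc (a C 2) 1 d ⟨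
  a C 2 + 1 + d     ≤⟨ ℕₚ.+-monoˡ-≤ d lower ⟩
  k + d             ≡⟨ k+d≡ ⟩
  suc a C 2         ≡⟨ nCk+nC[k+1]≡[n+1]C[k+1] a 1 ⟨
  a C 1 + a C 2     ≡⟨ cong (_+ a C 2) (nC1≡n a) ⟩
  a + a C 2         ≡⟨ ℕₚ.+-comm a (a C 2) ⟩
  a C 2 + a         ∎))
  where open ≤-Reasoning

even-split : ∀ {n a} → a ≤ n → (n ∸ a) % 2 ≡ 0 → n ≡ a + 2 * ((n ∸ a) / 2)
even-split {n} {a} a≤n even = begin
  n                                    ≡⟨ ℕₚ.m+[n∸m]≡n a≤n ⟨
  a + (n ∸ a)                          ≡⟨ cong (_+_ a) (ℕ.m≡m%n+[m/n]*n (n ∸ a) 2) ⟩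
  a + ((n ∸ a) % 2 + (n ∸ a) / 2 * 2)  ≡⟨ cong (λ r → a + (r + (n ∸ a) / 2 * 2)) even ⟩
  a + (n ∸ a) / 2 * 2                  ≡⟨ cong (_+_ a) (ℕₚ.*-comm ((n ∸ a) / 2) 2) ⟩
  a + 2 * ((n ∸ a) / 2)                ∎
  where open ≡-Reasoning

a≤[n+4]/5⇒5a≤n+4 : ∀ {n a} → a ≤ (n + 4) / 5 → a * 5 ≤ n + 4
a≤[n+4]/5⇒5a≤n+4 {n} a≤ = ℕₚ.≤-trans (ℕₚ.*-monoˡ-≤ 5 a≤) (ℕ.m/n*n≤m (n + 4) 5)

5a≤n+4⇒a≤n : ∀ {n a} → 1 ≤ a → a * 5 ≤ n + 4 → a ≤ n
5a≤n+4⇒a≤n {n} {a} 1≤a 5a≤n+4 = ℕₚ.+-cancelʳ-≤ 4 a n (begin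
  a + 4        ≤⟨ ℕₚ.+-monoʳ-≤ a (ℕₚ.*-monoʳ-≤ 4 1≤a) ⟩
  a + 4 * a    ≡⟨ five a ⟩
  a * 5        ≤⟨ 5a≤n+4 ⟩
  n + 4        ∎)
  where
  open ≤-Reasoning
  five : ∀ a → a + 4 * a ≡ a * 5
  five = solve-∀

5a≤n+4⇒2a≤t+2 : ∀ {a t} → a * 5 ≤ (a + 2 * t) + 4 → 2 * a ≤ t + 2
5a≤n+4⇒2a≤t+2 {a} {t} 5a≤n+4 = ℕₚ.*-cancelˡ-≤ 2 (ℕₚ.+-cancelˡ-≤ a _ _ (begin
  a + 2 * (2 * a)     ≡⟨ regroup a ⟩
  a * 5               ≤⟨ 5a≤n+4 ⟩
  (a + 2 * t) + 4     ≡⟨ regroup′ a t ⟩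
  a + 2 * (t + 2)     ∎))
  where
  open ≤-Reasoning
  regroup : ∀ a → a + 2 * (2 * a) ≡ a * 5
  regroup = solve-∀
  regroup′ : ∀ a t → (a + 2 * t) + 4 ≡ a + 2 * (t + 2)
  regroup′ = solve-∀

-- Column lengths of the partition (5, 4, 2).
five-four-two : List ℕ
five-four-two = 3 ∷ 3 ∷ 2 ∷ 2 ∷ 1 ∷ []

five-four-two-below : ∀ {a} → 4 ≤ a → All (_< a) five-four-two
five-four-two-below 4≤a = 4≤a ∷ 4≤a ∷ 3≤a ∷ 3≤a ∷ ℕₚ.<⇒≤ 3≤a ∷ []
  where 3≤a = ℕₚ.<⇒≤ 4≤a

-- The frame around (a, 5, 4, 2) needs t ≥ a + 6.  This fails for a = 4, which uses the
-- frame around (5, 2, 1, 1) instead, and for (a, t) = (6, 11) and (7, 12), which use the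
-- shapes with column lengths (11, 6, 1^11) and (7, 7, 5, 5, 1^7).
eigenvalue-binomial-minus-2 : ∀ b {t k} → k + 2 ≡ (4 + b) C 2 → 2 * (4 + b) ≤ t + 2 → 27 ≤ (4 + b) + 2 * t →
                              IsEigenvalue ((4 + b) + 2 * t) (+ k)
eigenvalue-binomial-minus-2 0 {t} {k} binomial _ 27≤n
  with ℕₚ.m≤n⇒∃[o]m+o≡n (27≤a+2t⇒a+c≤t {4} {t} {4} (ℕₚ.≤ᵇ⇒≤ _ _ tt) 27≤n)
... | l , refl = subst (λ n → IsEigenvalue n (+ k)) (trans (sum-frame l (addRow 3 (3 ∷ 1 ∷ []))) (cells l))
  (frame-eigenvalue (3 ∷ 1 ∷ []) 3 l {k} {6} (ℕₚ.≤ᵇ⇒≤ _ _ tt ∷ ℕₚ.≤ᵇ⇒≤ _ _ tt ∷ []) refl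
    (trans (sym (ℕₚ.+-assoc k 2 4)) (cong (_+ 4) binomial)))
  where
  cells : ∀ l → suc (9 + 2 * (5 + l)) ≡ 4 + 2 * (8 + l)
  cells = solve-∀
eigenvalue-binomial-minus-2 1 {t} {k} binomial _ 27≤n =
  framed-row-eigenvalue five-four-two {5} {5} {t} {k} {2} ℕₚ.≤-refl (five-four-two-below (ℕₚ.n≤1+n 4))
    refl refl binomial (27≤a+2t⇒a+c≤t {5} {t} {6} (ℕₚ.≤ᵇ⇒≤ _ _ tt) 27≤n)
eigenvalue-binomial-minus-2 2 {t} {k} binomial _ 27≤n with t ≟ 11
... | yes refl = subst (λ k → IsEigenvalue 28 (+ k)) (sym (ℕₚ.+-cancelʳ-≡ 2 k 13 binomial))
                   (column-eigenvalue (11 ∷ 6 ∷ replicate 11 1) (+ 13) refl)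
... | no t≢11  =
  framed-row-eigenvalue five-four-two {6} {5} {t} {k} {2} (ℕₚ.n≤1+n 5) (five-four-two-below (ℕₚ.≤ᵇ⇒≤ _ _ tt))
    refl refl binomial (ℕₚ.≤∧≢⇒< (27≤a+2t⇒a+c≤t {6} {t} {5} (ℕₚ.≤ᵇ⇒≤ _ _ tt) 27≤n) (t≢11 ∘ sym))
eigenvalue-binomial-minus-2 3 {t} {k} binomial 14≤t+2 _ with t ≟ 12
... | yes refl = subst (λ k → IsEigenvalue 31 (+ k)) (sym (ℕₚ.+-cancelʳ-≡ 2 k 19 binomial))
                   (column-eigenvalue (7 ∷ 7 ∷ 5 ∷ 5 ∷ replicate 7 1) (+ 19) refl)
... | no t≢12  =
  framed-row-eigenvalue five-four-two {7} {5} {t} {k} {2} (ℕₚ.≤ᵇ⇒≤ _ _ tt) (five-four-two-below (ℕₚ.≤ᵇ⇒≤ _ _ tt))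
    refl refl binomial (ℕₚ.≤∧≢⇒< (2a≤t+2⇒a+c≤t {7} {t} {5} 14≤t+2 ℕₚ.≤-refl) (t≢12 ∘ sym))
eigenvalue-binomial-minus-2 (suc (suc (suc (suc b)))) {t} {k} binomial 2a≤t+2 _ =
  framed-row-eigenvalue five-four-two {8 + b} {5} {t} {k} {2} (ℕₚ.≤-trans (ℕₚ.≤ᵇ⇒≤ 5 8 tt) 8≤a)
    (five-four-two-below (ℕₚ.≤-trans (ℕₚ.≤ᵇ⇒≤ 4 8 tt) 8≤a)) refl refl binomial (2a≤t+2⇒a+c≤t 2a≤t+2 8≤a)
  where 8≤a = ℕₚ.m≤m+n 8 b

eigenvalue-near-binomial : ∀ {a t} d {k} → k + d ≡ a C 2 → 3 ≤ a → 2 + d ≤ a → 2 * a ≤ t + 2 → 27 ≤ a + 2 * t →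
                           IsEigenvalue (a + 2 * t) (+ k)
eigenvalue-near-binomial {a} {t} 0 {k} binomial 3≤a _ 2a≤t+2 27≤n with ℕₚ.m≤n⇒m<n∨m≡n 3≤a
... | inj₁ 4≤a  = framed-row-eigenvalue (1 ∷ 1 ∷ 1 ∷ []) {a} {1} {t} {k} {0} 3≤a (2≤a ∷ 2≤a ∷ 2≤a ∷ [])
                    refl refl binomial (2a≤t+2⇒a+c≤t 2a≤t+2 4≤a)
  where 2≤a = ℕₚ.<⇒≤ 3≤a
... | inj₂ refl = framed-row-eigenvalue (1 ∷ 1 ∷ 1 ∷ []) {3} {1} {t} {k} {0} 3≤a (2≤3 ∷ 2≤3 ∷ 2≤3 ∷ [])
                    refl refl binomial (27≤a+2t⇒a+c≤t {3} {t} {2} (ℕₚ.≤ᵇ⇒≤ _ _ tt) 27≤n)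
  where 2≤3 = ℕₚ.n≤1+n 2
eigenvalue-near-binomial {a} {t} 1 {k} binomial 3≤a _ 2a≤t+2 _ =
  framed-row-eigenvalue (1 ∷ []) {a} {0} {t} {k} {1} (ℕₚ.<⇒≤ (ℕₚ.<⇒≤ 3≤a)) (ℕₚ.<⇒≤ 3≤a ∷ [])
    refl refl binomial (2a≤t+2⇒a+c≤t 2a≤t+2 3≤a)
eigenvalue-near-binomial {a} {t} 2 binomial _ 4≤a 2a≤t+2 27≤n with ℕₚ.m≤n⇒∃[o]m+o≡n 4≤a
... | b , refl = eigenvalue-binomial-minus-2 b binomial 2a≤t+2 27≤n
eigenvalue-near-binomial {a} {t} (suc (suc (suc e))) {k} binomial _ 5+e≤a 2a≤t+2 _ =
  framed-row-eigenvalue (nearHook e) {a} {2 + e} {t} {k} {3 + e} fits short size (nearHook-content e)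
    binomial (2a≤t+2⇒a+c≤t 2a≤t+2 5+e≤a)
  where
  3+e≤a : 3 + e ≤ a
  3+e≤a = ℕₚ.≤-trans (ℕₚ.m≤n+m (3 + e) 2) 5+e≤a
  fits : length (nearHook e) ≤ a
  fits = subst (_≤ a) (sym (length-addRow (suc e) (suc e ∷ 1 ∷ []))) 3+e≤a
  3≤a = ℕₚ.≤-trans (ℕₚ.m≤m+n 3 e) 3+e≤a
  short : All (_< a) (nearHook e)
  short = 3+e≤a ∷ 3≤a ∷ Allₚ.replicate⁺ (suc e) (ℕₚ.<⇒≤ 3≤a)
  size : sum (nearHook e) ≡ suc (2 * (2 + e))
  size = trans (sum-addRow (suc e) (suc e ∷ 1 ∷ [])) (regroup e)
    where
    regroup : ∀ e → (suc e + (1 + 0)) + (2 + suc e) ≡ suc (2 * (2 + e))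
    regroup = solve-∀

corollary3p2 : ∀ (n : ℕ) → 27 ≤ n →
    ∀ (a : ℕ) → 3 ≤ a → a ≤ (n + 4) / 5 → (n ∸ a) % 2 ≡ 0 →
    ∀ (k : ℕ) → ((a ∸ 1) C 2) + 1 ≤ k → k ≤ a C 2 →
    IsEigenvalue n (+ k)
corollary3p2 n 27≤n a 3≤a a≤[n+4]/5 even k lower upper with binomial-gap (ℕₚ.<⇒≤ (ℕₚ.<⇒≤ 3≤a)) lower upper
... | d , k+d≡ , 2+d≤a =
  subst (λ m → IsEigenvalue m (+ k)) (sym n≡a+2t)
    (eigenvalue-near-binomial {a} {t} d k+d≡ 3≤a 2+d≤a
      (5a≤n+4⇒2a≤t+2 {a} {t} (subst (λ m → a * 5 ≤ m + 4) n≡a+2t 5a≤n+4))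
      (subst (27 ≤_) n≡a+2t 27≤n))
  where
  t = (n ∸ a) / 2
  5a≤n+4 = a≤[n+4]/5⇒5a≤n+4 {n} a≤[n+4]/5
  n≡a+2t : n ≡ a + 2 * t
  n≡a+2t = even-split (5a≤n+4⇒a≤n (ℕₚ.<⇒≤ (ℕₚ.<⇒≤ 3≤a)) 5a≤n+4) even
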